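{- Let $\mathcal{T}_n^+$ denote $\mathcal{T}_n$ together with (all translates of) the $2\times 2$ square. A $p\times q$ rectangle admits a signed tiling by $\mathcal{T}_4^+$ if and only if both $p$ and $q$ are even. For $n\ge 6$ even, a $p\times q$ rectangle admits a signed tiling by $\mathcal{T}_n^+$ if and only if either both $p,q$ are even, or one of $p,q$ is odd and the other is divisible by $n\left(\frac{n}{2}-2\right)$.
   Context: Identify the unit cell $[a,a+1]\times[b,b+1]$ with $(a,b)\in\mathbb{Z}^2$. For $n$ even, $\mathcal{T}_n$ consists of all integer translates of the four polyominoes with cell sets $\{(0,j):0\le j\le n-2\}\cup\{(1,0)\}$, $\{(1,j):0\le j\le n-2\}\cup\{(0,n-2)\}$, $\{(i,0):0\le i\le n-2\}\cup\{(0,1)\}$, $\{(i,1):0\le i\le n-2\}\cup\{(n-2,0)\}$ (translations only). A signed tiling of a region $R$ (finite set of cells) is a finite collection of translated tiles with weights $\pm1$ such that the weights of tiles covering each cell sum to $1$ for cells in $R$ and to $0$ for cells outside $R$. -}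

module Defs where

open import Data.Nat as ℕ using (ℕ; _∸_)
open import Data.Integer as ℤ using (ℤ; +_; 0ℤ; 1ℤ; -1ℤ)
open import Data.Product using (_×_; _,_; Σ)
open import Data.Product.Properties using (≡-dec)
open import Data.List using (List; []; _∷_; map; upTo; foldr)
open import Data.List.Membership.Propositional using (_∈_)
open import Data.Sign using (Sign)
open import Relation.Nullary using (¬_; yes; no)
open import Relation.Binary.PropositionalEquality using (_≡_)
open import Relation.Binary.Definitions using (DecidableEquality)

-- A unit cell [a,a+1]×[b,b+1] is identified with (a , b).
Cell : Set
Cell = ℤ × ℤ

_≟c_ : DecidableEquality Cell
_≟c_ = ≡-dec ℤ._≟_ ℤ._≟_

open import Data.List.Membership.DecPropositional _≟c_ using (_∈?_)

Tile : Set
Tile = List Cell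

TileSet : Set
TileSet = List Tile

translate : Cell → Tile → Tile
translate (a , b) = map (λ { (x , y) → (x ℤ.+ a , y ℤ.+ b) })

tileA : ℕ → Tile
tileA n = (+ 1 , + 0) ∷ map (λ j → (+ 0 , + j)) (upTo (n ∸ 1))
tileB : ℕ → Tile
tileB n = (+ 0 , + (n ∸ 2)) ∷ map (λ j → (+ 1 , + j)) (upTo (n ∸ 1))
tileC : ℕ → Tile
tileC n = (+ 0 , + 1) ∷ map (λ i → (+ i , + 0)) (upTo (n ∸ 1))
tileD : ℕ → Tile
tileD n = (+ (n ∸ 2) , + 0) ∷ map (λ i → (+ i , + 1)) (upTo (n ∸ 1))

square2 : Tile
square2 = (+ 0 , + 0) ∷ (+ 1 , + 0) ∷ (+ 0 , + 1) ∷ (+ 1 , + 1) ∷ []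

𝒯 : ℕ → TileSet
𝒯 n = tileA n ∷ tileB n ∷ tileC n ∷ tileD n ∷ []

𝒯⁺ : ℕ → TileSet
𝒯⁺ n = square2 ∷ 𝒯 n

record Placement (T : TileSet) : Set where
  constructor place
  field
    proto  : Tile
    proto∈ : proto ∈ T
    offset : Cell
    sign   : Sign

weight : Sign → ℤ
weight Sign.+ = 1ℤ
weight Sign.- = -1ℤ

covers : ∀ {T} → Placement T → Cell → ℤ
covers (place t _ off s) c with c ∈? translate off t
... | yes _ = weight s
... | no  _ = 0ℤ

coverage : ∀ {T} → List (Placement T) → Cell → ℤ
coverage ps c = foldr ℤ._+_ 0ℤ (map (λ p → covers p c) ps)

Region : Set₁
Region = Cell → Set

IsSignedTiling : (T : TileSet) → Region → List (Placement T) → Set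
IsSignedTiling T R ps =
  (∀ c → R c → coverage ps c ≡ 1ℤ) × (∀ c → ¬ R c → coverage ps c ≡ 0ℤ)

SignedTileable : TileSet → Region → Set
SignedTileable T R = Σ (List (Placement T)) (IsSignedTiling T R)

Rect : ℕ → ℕ → Region
Rect p q (x , y) = (0ℤ ℤ.≤ x × x ℤ.< + p) × (0ℤ ℤ.≤ y × y ℤ.< + q)

-- A signed tiling writes the indicator of a region as a ℤ-combination of translated tiles, so for any
-- weight W on cells the W-sum of the rectangle is a signed sum of W-sums of translated tiles. Write
-- n = 2k + 2: apart from the square, every tile of 𝒯ₙ⁺ is a bar of odd length 2k + 1 plus one cell, and
-- for W(x, y) = (-1)^(x+y) (α x + β y + γ) the square has W-sum 0 while the other tiles have W-sums
-- ±(β k − α) or ±(α k − β). The weight (0, 0, 1) rules out odd × odd rectangles, and (k, 1, 0) shows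
-- that k² − 1 divides q/2 when p is odd and q even; note 2 (k² − 1) = n (n/2 − 2).
--
-- Conversely, modulo tileable combinations, the vertical domino V(a, b) satisfies V(a, b) ≡ V(a+1, b+1)
-- (three C tiles and a D tile, whose horizontal bars telescope) and V(a, b) + V(a+1, b) ≡ 0 (a square),
-- hence V(a, b + j) ≡ (-1)^j V(a, b). Cutting the bar of an A tile into dominoes gives H ≡ k V for the
-- horizontal domino H, and transposing gives V ≡ k H, so (k² − 1) V ≡ 0. A column of height 2h is then
-- ≡ h V, tileable when k² − 1 divides h, and squares cover the remaining columns in pairs.
module Submission where

open import Defs

open import Algebra.Bundles using (AbelianGroup)
open import Data.Empty using (⊥-elim)
open import Data.Integer as ℤ using (ℤ; +_; -[1+_]; 0ℤ; 1ℤ; -1ℤ; _+_; _*_; -_; _-_)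
open import Data.Integer.Divisibility.Signed as ℤ∣ using () renaming (_∣_ to _∣ℤ_)
import Data.Integer.Properties as ℤ
open import Data.Integer.Tactic.RingSolver using (solve-∀)
open import Data.List using (List; []; _∷_; map; upTo; applyUpTo; foldr; _++_; cartesianProduct; deduplicate; concatMap)
open import Data.List.Membership.DecPropositional _≟c_ using (_∈?_)
open import Data.List.Membership.Propositional using (_∈_; _∉_)
open import Data.List.Membership.Propositional.Properties
  using ( ∈-map⁺; ∈-map⁻; ∈-upTo⁺; ∈-upTo⁻; ∈-cartesianProduct⁺; ∈-cartesianProduct⁻
        ; ∈-deduplicate⁺; ∈-++⁺ˡ; ∈-++⁺ʳ; ∈-concat⁺′)
open import Data.List.Properties using (map-∘)
open import Data.List.Relation.Unary.All as All using (All; []; _∷_)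
open import Data.List.Relation.Unary.AllPairs using ([]; _∷_)
open import Data.List.Relation.Unary.Any using (here; there)
open import Data.List.Relation.Unary.Unique.Propositional using (Unique)
import Data.List.Relation.Unary.Unique.DecPropositional.Properties as Unique
import Data.List.Relation.Unary.Unique.Propositional.Properties as Unique
open import Data.Nat as ℕ using (ℕ; zero; suc; s≤s; _/_; _∸_; _≤_)
open import Data.Nat.DivMod using (m*n/n≡m)
open import Data.Nat.Divisibility using (_∣_; divides; 0∣⇒≡0; 1∣_)
import Data.Nat.Properties as ℕ
open import Data.Product using (_×_; _,_; Σ-syntax; ∃; proj₁; proj₂; swap)
import Data.Sign as Sign
open import Data.Sum using (_⊎_; inj₁; inj₂)
open import Function using (_∘_)
open import Function.Bundles using (_⇔_; mk⇔; Equivalence)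
open import Function.Properties.Equivalence using (⇔-setoid) renaming (trans to ⇔-trans; sym to ⇔-sym)
open import Level using (0ℓ)
open import Relation.Binary.Bundles using (Setoid)
open import Relation.Binary.PropositionalEquality
import Relation.Binary.Reasoning.Setoid as SetoidReasoning
open import Relation.Binary.Structures using (IsEquivalence)
open import Relation.Nullary using (¬_; yes; no; Dec)

open import Algebra.Properties.Group (AbelianGroup.group ℤ.+-0-abelianGroup) using () renaming (∙-cancelʳ to +-cancelʳ)

double : ℕ → ℕ
double zero    = zero
double (suc n) = suc (suc (double n))

data Parity : ℕ → Set where
  even : ∀ h → Parity (double h)
  odd  : ∀ h → Parity (suc (double h))

parity : ∀ n → Parity n
parity zero = even 0
parity (suc n) with parity n
... | even h = odd h
... | odd h  = even (suc h)

double≡+ : ∀ n → double n ≡ n ℕ.+ n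
double≡+ zero    = refl
double≡+ (suc n) = cong suc (trans (cong suc (double≡+ n)) (sym (ℕ.+-suc n n)))

double≡*2 : ∀ n → double n ≡ n ℕ.* 2
double≡*2 n = trans (double≡+ n) (trans (cong (n ℕ.+_) (sym (ℕ.+-identityʳ n))) (ℕ.*-comm 2 n))

double≢odd : ∀ m n → double m ≢ suc (double n)
double≢odd (suc m) (suc n) eq = double≢odd m n (ℕ.suc-injective (ℕ.suc-injective eq))

*-double : ∀ t m → double (t ℕ.* m) ≡ t ℕ.* double m
*-double t m = trans (double≡+ (t ℕ.* m)) (trans (sym (ℕ.*-distribˡ-+ t m m)) (cong (t ℕ.*_) (sym (double≡+ m))))

double-injective : ∀ {m n} → double m ≡ double n → m ≡ n
double-injective {zero}  {zero}  _  = refl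
double-injective {suc m} {suc n} eq = cong suc (double-injective (ℕ.suc-injective (ℕ.suc-injective eq)))

∣⇔double∣double : ∀ m h → m ∣ h ⇔ double m ∣ double h
∣⇔double∣double m h = mk⇔
  (λ (divides t h≡t*m) → divides t (trans (cong double h≡t*m) (*-double t m)))
  (λ (divides t eq) → divides t (double-injective (trans eq (sym (*-double t m)))))

double∤odd : ∀ m n → ¬ double m ∣ suc (double n)
double∤odd m n (divides t eq) = double≢odd (t ℕ.* m) n (trans (*-double t m) (sym eq))

2∣double : ∀ n → 2 ∣ double n
2∣double n = Equivalence.to (∣⇔double∣double 1 n) (1∣ n)

2∤odd : ∀ n → ¬ 2 ∣ suc (double n)
2∤odd = double∤odd 1

∑ : ℕ → (ℕ → ℤ) → ℤ
∑ zero    f = 0ℤ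
∑ (suc n) f = f 0 + ∑ n (f ∘ suc)

infix 5 ∑
syntax ∑ n (λ i → e) = ∑[ i < n ] e

∑-cong : ∀ n {f g : ℕ → ℤ} → (∀ i → f i ≡ g i) → ∑ n f ≡ ∑ n g
∑-cong zero    eq = refl
∑-cong (suc n) eq = cong₂ _+_ (eq 0) (∑-cong n (eq ∘ suc))

∑-zero : ∀ n → ∑[ i < n ] 0ℤ ≡ 0ℤ
∑-zero zero    = refl
∑-zero (suc n) = trans (ℤ.+-identityˡ _) (∑-zero n)

∑-+ : ∀ n (f g : ℕ → ℤ) → ∑[ i < n ] (f i + g i) ≡ ∑ n f + ∑ n g
∑-+ zero    f g = refl
∑-+ (suc n) f g = begin
  f 0 + g 0 + (∑[ i < n ] (f (suc i) + g (suc i))) ≡⟨ cong (_+_ (f 0 + g 0)) (∑-+ n (f ∘ suc) (g ∘ suc)) ⟩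
  f 0 + g 0 + (∑ n (f ∘ suc) + ∑ n (g ∘ suc))    ≡⟨ medial (f 0) (g 0) _ _ ⟩
  f 0 + ∑ n (f ∘ suc) + (g 0 + ∑ n (g ∘ suc))    ∎
  where
  open ≡-Reasoning
  medial : ∀ a b c d → a + b + (c + d) ≡ a + c + (b + d)
  medial = solve-∀

∑-*ˡ : ∀ n a (f : ℕ → ℤ) → ∑[ i < n ] (a * f i) ≡ a * ∑ n f
∑-*ˡ zero    a f = sym (ℤ.*-zeroʳ a)
∑-*ˡ (suc n) a f =
  trans (cong (_+_ (a * f 0)) (∑-*ˡ n a (f ∘ suc))) (sym (ℤ.*-distribˡ-+ a (f 0) _))

∑-const : ∀ n a → ∑[ i < n ] a ≡ + n * a
∑-const zero    a = sym (ℤ.*-zeroˡ a)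
∑-const (suc n) a = begin
  a + (∑[ i < n ] a) ≡⟨ cong (_+_ a) (∑-const n a) ⟩
  a + + n * a      ≡⟨ cong (λ z → z + + n * a) (sym (ℤ.*-identityˡ a)) ⟩
  1ℤ * a + + n * a ≡⟨ sym (ℤ.*-distribʳ-+ a 1ℤ (+ n)) ⟩
  + suc n * a      ∎
  where open ≡-Reasoning

∑-comm : ∀ m n (f : ℕ → ℕ → ℤ) → ∑[ i < m ] ∑[ j < n ] f i j ≡ ∑[ j < n ] ∑[ i < m ] f i j
∑-comm zero    n f = sym (∑-zero n)
∑-comm (suc m) n f =
  trans (cong (_+_ (∑ n (f 0))) (∑-comm m n (f ∘ suc))) (sym (∑-+ n (f 0) _))

∑-pairs : ∀ h (f : ℕ → ℤ) → ∑ (double h) f ≡ ∑[ i < h ] (f (double i) + f (suc (double i)))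
∑-pairs zero    f = refl
∑-pairs (suc h) f =
  trans (cong (λ s → f 0 + (f 1 + s)) (∑-pairs h (f ∘ suc ∘ suc))) (sym (ℤ.+-assoc (f 0) (f 1) _))

∑-telescope : ∀ n (f : ℕ → ℤ) → ∑ n f - ∑ n (f ∘ suc) ≡ f 0 - f n
∑-telescope zero    f = sym (ℤ.+-inverseʳ (f 0))
∑-telescope (suc n) f = begin
  f 0 + S - (f 1 + S′) ≡⟨ shuffle (f 0) (f 1) S S′ ⟩
  f 0 - f 1 + (S - S′) ≡⟨ cong (_+_ (f 0 - f 1)) (∑-telescope n (f ∘ suc)) ⟩
  f 0 - f 1 + (f 1 - f (suc n)) ≡⟨ cancel (f 0) (f 1) (f (suc n)) ⟩
  f 0 - f (suc n) ∎
  where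
  open ≡-Reasoning
  S S′ : ℤ
  S = ∑ n (f ∘ suc)
  S′ = ∑ n (f ∘ suc ∘ suc)
  shuffle : ∀ a b s t → a + s - (b + t) ≡ a - b + (s - t)
  shuffle = solve-∀
  cancel : ∀ a b c → a - b + (b - c) ≡ a - c
  cancel = solve-∀

∑-neg : ∀ n (f : ℕ → ℤ) → ∑[ i < n ] (- f i) ≡ - ∑ n f
∑-neg n f = begin
  ∑[ i < n ] (- f i)     ≡⟨ ∑-cong n (λ i → sym (ℤ.-1*i≡-i (f i))) ⟩
  ∑[ i < n ] (-1ℤ * f i) ≡⟨ ∑-*ˡ n -1ℤ f ⟩
  -1ℤ * ∑ n f            ≡⟨ ℤ.-1*i≡-i _ ⟩
  - ∑ n f                ∎
  where open ≡-Reasoning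

∑-- : ∀ n (f g : ℕ → ℤ) → ∑[ i < n ] (f i - g i) ≡ ∑ n f - ∑ n g
∑-- n f g = trans (∑-+ n f (λ i → - g i)) (cong (_+_ (∑ n f)) (∑-neg n g))

∑ᴸ : {A : Set} → List A → (A → ℤ) → ℤ
∑ᴸ xs f = foldr _+_ 0ℤ (map f xs)

private
  variable
    A B : Set

∑ᴸ-cong : ∀ (xs : List A) {f g : A → ℤ} → (∀ x → f x ≡ g x) → ∑ᴸ xs f ≡ ∑ᴸ xs g
∑ᴸ-cong []       eq = refl
∑ᴸ-cong (x ∷ xs) eq = cong₂ _+_ (eq x) (∑ᴸ-cong xs eq)

∑ᴸ-zero : ∀ (xs : List A) {f : A → ℤ} → All (λ x → f x ≡ 0ℤ) xs → ∑ᴸ xs f ≡ 0ℤ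
∑ᴸ-zero []       []       = refl
∑ᴸ-zero (x ∷ xs) (p ∷ ps) = cong₂ _+_ p (∑ᴸ-zero xs ps)

∑ᴸ-++ : ∀ (xs ys : List A) (f : A → ℤ) → ∑ᴸ (xs ++ ys) f ≡ ∑ᴸ xs f + ∑ᴸ ys f
∑ᴸ-++ []       ys f = sym (ℤ.+-identityˡ _)
∑ᴸ-++ (x ∷ xs) ys f = trans (cong (_+_ (f x)) (∑ᴸ-++ xs ys f)) (sym (ℤ.+-assoc (f x) _ _))

∑ᴸ-+ : ∀ (xs : List A) (f g : A → ℤ) → ∑ᴸ xs (λ x → f x + g x) ≡ ∑ᴸ xs f + ∑ᴸ xs g
∑ᴸ-+ []       f g = refl
∑ᴸ-+ (x ∷ xs) f g =
  trans (cong (_+_ (f x + g x)) (∑ᴸ-+ xs f g)) (medial (f x) (g x) _ _)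
  where
  medial : ∀ a b c d → a + b + (c + d) ≡ a + c + (b + d)
  medial = solve-∀

∑ᴸ-*ˡ : ∀ (xs : List A) a (f : A → ℤ) → ∑ᴸ xs (λ x → a * f x) ≡ a * ∑ᴸ xs f
∑ᴸ-*ˡ []       a f = sym (ℤ.*-zeroʳ a)
∑ᴸ-*ˡ (x ∷ xs) a f =
  trans (cong (_+_ (a * f x)) (∑ᴸ-*ˡ xs a f)) (sym (ℤ.*-distribˡ-+ a (f x) _))

∑ᴸ-comm : ∀ (xs : List A) (ys : List B) (f : A → B → ℤ) →
  ∑ᴸ xs (λ x → ∑ᴸ ys (f x)) ≡ ∑ᴸ ys (λ y → ∑ᴸ xs (λ x → f x y))
∑ᴸ-comm []       ys f = sym (∑ᴸ-zero ys (All.universal (λ _ → refl) ys))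
∑ᴸ-comm (x ∷ xs) ys f =
  trans (cong (_+_ (∑ᴸ ys (f x))) (∑ᴸ-comm xs ys f)) (sym (∑ᴸ-+ ys (f x) _))

∑ᴸ-cong-∈ : ∀ (xs : List A) {f g : A → ℤ} → (∀ {x} → x ∈ xs → f x ≡ g x) → ∑ᴸ xs f ≡ ∑ᴸ xs g
∑ᴸ-cong-∈ []       eq = refl
∑ᴸ-cong-∈ (x ∷ xs) eq = cong₂ _+_ (eq (here refl)) (∑ᴸ-cong-∈ xs (eq ∘ there))

∑ᴸ-map : ∀ (g : A → B) (xs : List A) (f : B → ℤ) → ∑ᴸ (map g xs) f ≡ ∑ᴸ xs (f ∘ g)
∑ᴸ-map g []       f = refl
∑ᴸ-map g (x ∷ xs) f = cong (_+_ (f (g x))) (∑ᴸ-map g xs f)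

∑ᴸ-cartesianProduct : ∀ (xs : List A) (ys : List B) (F : A × B → ℤ) →
  ∑ᴸ (cartesianProduct xs ys) F ≡ ∑ᴸ xs (λ x → ∑ᴸ ys (F ∘ (x ,_)))
∑ᴸ-cartesianProduct []       ys F = refl
∑ᴸ-cartesianProduct (x ∷ xs) ys F = trans (∑ᴸ-++ (map (x ,_) ys) _ F)
  (cong₂ _+_ (∑ᴸ-map (x ,_) ys F) (∑ᴸ-cartesianProduct xs ys F))

∑ᴸ-applyUpTo : ∀ n (h : ℕ → ℕ) (f : ℕ → ℤ) → ∑ᴸ (applyUpTo h n) f ≡ ∑ n (f ∘ h)
∑ᴸ-applyUpTo zero    h f = refl
∑ᴸ-applyUpTo (suc n) h f = cong (_+_ (f (h 0))) (∑ᴸ-applyUpTo n (h ∘ suc) f)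

∑ᴸ-upTo : ∀ n (f : ℕ → ℤ) → ∑ᴸ (upTo n) f ≡ ∑ n f
∑ᴸ-upTo n = ∑ᴸ-applyUpTo n (λ i → i)

δ : Cell → Cell → ℤ
δ x c with c ≟c x
... | yes _ = 1ℤ
... | no  _ = 0ℤ

δ-≡ : ∀ {x c} → c ≡ x → δ x c ≡ 1ℤ
δ-≡ {x} {c} c≡x with c ≟c x
... | yes _   = refl
... | no  c≢x = ⊥-elim (c≢x c≡x)

δ-≢ : ∀ {x c} → c ≢ x → δ x c ≡ 0ℤ
δ-≢ {x} {c} c≢x with c ≟c x
... | yes c≡x = ⊥-elim (c≢x c≡x)
... | no  _   = refl

𝟙 : List Cell → Cell → ℤ
𝟙 xs c with c ∈? xs
... | yes _ = 1ℤ
... | no  _ = 0ℤ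

𝟙-∈ : ∀ {xs c} → c ∈ xs → 𝟙 xs c ≡ 1ℤ
𝟙-∈ {xs} {c} c∈xs with c ∈? xs
... | yes _   = refl
... | no  c∉xs = ⊥-elim (c∉xs c∈xs)

𝟙-∉ : ∀ {xs c} → c ∉ xs → 𝟙 xs c ≡ 0ℤ
𝟙-∉ {xs} {c} c∉xs with c ∈? xs
... | yes c∈xs = ⊥-elim (c∉xs c∈xs)
... | no  _    = refl

𝟙-cong : ∀ {xs ys c d} → (c ∈ xs ⇔ d ∈ ys) → 𝟙 xs c ≡ 𝟙 ys d
𝟙-cong {xs} {ys} {c} {d} c∈⇔d∈ with c ∈? xs
... | yes c∈xs = sym (𝟙-∈ (Equivalence.to c∈⇔d∈ c∈xs))
... | no  c∉xs = sym (𝟙-∉ (c∉xs ∘ Equivalence.from c∈⇔d∈))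

∑ᴸ-δ-∉ : ∀ {c} xs → c ∉ xs → ∑ᴸ xs (λ x → δ x c) ≡ 0ℤ
∑ᴸ-δ-∉ xs c∉xs = ∑ᴸ-zero xs (All.tabulate (λ x∈xs → δ-≢ (λ { refl → c∉xs x∈xs })))

𝟙≡∑ᴸδ : ∀ {xs} → Unique xs → ∀ c → 𝟙 xs c ≡ ∑ᴸ xs (λ x → δ x c)
𝟙≡∑ᴸδ {[]}     []            c = refl
𝟙≡∑ᴸδ {x ∷ xs} (x∉xs ∷ uniq) c = by-cases (c ≟c x)
  where
  open ≡-Reasoning
  by-cases : Dec (c ≡ x) → 𝟙 (x ∷ xs) c ≡ δ x c + ∑ᴸ xs (λ y → δ y c)
  by-cases (yes refl) = begin
    𝟙 (x ∷ xs) x                ≡⟨ 𝟙-∈ (here refl) ⟩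
    1ℤ                          ≡⟨ cong₂ _+_ (sym (δ-≡ {x} refl)) (sym (∑ᴸ-δ-∉ xs (λ x∈xs → All.lookup x∉xs x∈xs refl))) ⟩
    δ x x + ∑ᴸ xs (λ y → δ y x) ∎
  by-cases (no c≢x) = begin
    𝟙 (x ∷ xs) c                ≡⟨ 𝟙-cong (mk⇔ (λ { (here c≡x) → ⊥-elim (c≢x c≡x) ; (there c∈xs) → c∈xs }) there) ⟩
    𝟙 xs c                      ≡⟨ 𝟙≡∑ᴸδ uniq c ⟩
    ∑ᴸ xs (λ y → δ y c)         ≡⟨ sym (ℤ.+-identityˡ _) ⟩
    0ℤ + ∑ᴸ xs (λ y → δ y c)    ≡⟨ cong (λ z → z + ∑ᴸ xs (λ y → δ y c)) (sym (δ-≢ c≢x)) ⟩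
    δ x c + ∑ᴸ xs (λ y → δ y c) ∎

∑ᴸ-*δ : ∀ (W : Cell → ℤ) {L} → Unique L → ∀ {x} → x ∈ L → ∑ᴸ L (λ c → W c * δ x c) ≡ W x
∑ᴸ-*δ W {y ∷ L} (y∉L ∷ _) (here refl) = begin
  W y * δ y y + ∑ᴸ L (λ c → W c * δ y c) ≡⟨ cong₂ _+_ (cong (W y *_) (δ-≡ refl)) (∑ᴸ-zero L (All.map vanish y∉L)) ⟩
  W y * 1ℤ + 0ℤ                          ≡⟨ trans (ℤ.+-identityʳ _) (ℤ.*-identityʳ (W y)) ⟩
  W y                                    ∎
  where
  open ≡-Reasoning
  vanish : ∀ {c} → y ≢ c → W c * δ y c ≡ 0ℤ
  vanish {c} y≢c = trans (cong (W c *_) (δ-≢ (y≢c ∘ sym))) (ℤ.*-zeroʳ (W c))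
∑ᴸ-*δ W {y ∷ L} (y∉L ∷ uniq) {x} (there x∈L) = begin
  W y * δ x y + ∑ᴸ L (λ c → W c * δ x c) ≡⟨ cong₂ _+_ (cong (W y *_) (δ-≢ (All.lookup y∉L x∈L))) (∑ᴸ-*δ W uniq x∈L) ⟩
  W y * 0ℤ + W x                         ≡⟨ cong (_+ W x) (ℤ.*-zeroʳ (W y)) ⟩
  0ℤ + W x                               ≡⟨ ℤ.+-identityˡ (W x) ⟩
  W x                                    ∎
  where open ≡-Reasoning

∑ᴸ-*𝟙 : ∀ (W : Cell → ℤ) {L xs} → Unique L → Unique xs → (∀ {x} → x ∈ xs → x ∈ L) →
  ∑ᴸ L (λ c → W c * 𝟙 xs c) ≡ ∑ᴸ xs W
∑ᴸ-*𝟙 W {L} {xs} uniqL uniqxs xs⊆L = begin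
  ∑ᴸ L (λ c → W c * 𝟙 xs c)                  ≡⟨ ∑ᴸ-cong L (λ c → cong (W c *_) (𝟙≡∑ᴸδ uniqxs c)) ⟩
  ∑ᴸ L (λ c → W c * ∑ᴸ xs (λ x → δ x c))     ≡⟨ ∑ᴸ-cong L (λ c → sym (∑ᴸ-*ˡ xs (W c) _)) ⟩
  ∑ᴸ L (λ c → ∑ᴸ xs (λ x → W c * δ x c))     ≡⟨ ∑ᴸ-comm L xs _ ⟩
  ∑ᴸ xs (λ x → ∑ᴸ L (λ c → W c * δ x c))     ≡⟨ ∑ᴸ-cong-∈ xs (λ x∈xs → ∑ᴸ-*δ W uniqL (xs⊆L x∈xs)) ⟩
  ∑ᴸ xs W                                    ∎
  where open ≡-Reasoning

-- Integer chains and signed tileability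

Chain : Set
Chain = Cell → ℤ

infixl 6 _⊕_ _⊖_
infixr 7 _·_

_⊕_ : Chain → Chain → Chain
(f ⊕ g) c = f c + g c

_⊖_ : Chain → Chain → Chain
(f ⊖ g) c = f c - g c

_·_ : ℤ → Chain → Chain
(z · f) c = z * f c

𝟘 : Chain
𝟘 _ = 0ℤ

⨁ : ℕ → (ℕ → Chain) → Chain
⨁ n F c = ∑[ i < n ] F i c

infix 5 ⨁
syntax ⨁ n (λ i → F) = ⨁[ i < n ] F

-- Passing from regions to integer-valued functions makes tileability closed under ℤ-linear combinations.
Tileable : TileSet → Chain → Set
Tileable T f = Σ[ ps ∈ List (Placement T) ] coverage ps ≗ f

covers≡ : ∀ {T t} (t∈T : t ∈ T) o s c → covers (place t t∈T o s) c ≡ weight s * 𝟙 (translate o t) c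
covers≡ {t = t} t∈T o s c with c ∈? translate o t
... | yes _ = sym (ℤ.*-identityʳ (weight s))
... | no  _ = sym (ℤ.*-zeroʳ (weight s))

module _ {T : TileSet} where

  Tileable-resp : ∀ {f g} → f ≗ g → Tileable T f → Tileable T g
  Tileable-resp f≗g (ps , cov) = ps , λ c → trans (cov c) (f≗g c)

  Tileable-𝟘 : Tileable T 𝟘
  Tileable-𝟘 = [] , λ _ → refl

  Tileable-⊕ : ∀ {f g} → Tileable T f → Tileable T g → Tileable T (f ⊕ g)
  Tileable-⊕ (ps , cov-f) (qs , cov-g) =
    ps ++ qs , λ c → trans (∑ᴸ-++ ps qs (λ p → covers p c)) (cong₂ _+_ (cov-f c) (cov-g c))

  Tileable-neg : ∀ {f} → Tileable T f → Tileable T (-1ℤ · f)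
  Tileable-neg {f} (ps , cov) = map negate ps , λ c → begin
    ∑ᴸ (map negate ps) (λ p → covers p c) ≡⟨ ∑ᴸ-map negate ps _ ⟩
    ∑ᴸ ps (λ p → covers (negate p) c)     ≡⟨ ∑ᴸ-cong ps (λ p → covers-negate p c) ⟩
    ∑ᴸ ps (λ p → -1ℤ * covers p c)        ≡⟨ ∑ᴸ-*ˡ ps -1ℤ _ ⟩
    -1ℤ * coverage ps c                   ≡⟨ cong (-1ℤ *_) (cov c) ⟩
    -1ℤ * f c                             ∎
    where
    open ≡-Reasoning
    negate : Placement T → Placement T
    negate (place t t∈T o s) = place t t∈T o (Sign.opposite s)
    weight-opposite : ∀ s x → weight (Sign.opposite s) * x ≡ -1ℤ * (weight s * x)
    weight-opposite Sign.+ x = cong (-1ℤ *_) (sym (ℤ.*-identityˡ x))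
    weight-opposite Sign.- x = ℤ.*-assoc -1ℤ -1ℤ x
    covers-negate : ∀ p c → covers (negate p) c ≡ -1ℤ * covers p c
    covers-negate (place t t∈T o s) c = begin
      covers (place t t∈T o (Sign.opposite s)) c     ≡⟨ covers≡ t∈T o (Sign.opposite s) c ⟩
      weight (Sign.opposite s) * 𝟙 (translate o t) c ≡⟨ weight-opposite s _ ⟩
      -1ℤ * (weight s * 𝟙 (translate o t) c)         ≡⟨ cong (-1ℤ *_) (sym (covers≡ t∈T o s c)) ⟩
      -1ℤ * covers (place t t∈T o s) c               ∎

  Tileable-ℕ· : ∀ m {f} → Tileable T f → Tileable T (+ m · f)
  Tileable-ℕ· zero    {f} _ = Tileable-resp (λ c → sym (ℤ.*-zeroˡ (f c))) Tileable-𝟘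
  Tileable-ℕ· (suc m) {f} t = Tileable-resp (λ c → sym (ℤ.*-distribʳ-+ (f c) 1ℤ (+ m)))
    (Tileable-⊕ (Tileable-resp (λ c → sym (ℤ.*-identityˡ (f c))) t) (Tileable-ℕ· m t))

  Tileable-· : ∀ z {f} → Tileable T f → Tileable T (z · f)
  Tileable-· (+ m)     t = Tileable-ℕ· m t
  Tileable-· -[1+ m ] {f} t = Tileable-resp
    (λ c → trans (sym (ℤ.*-assoc -1ℤ (+ suc m) (f c))) (cong (_* f c) (ℤ.-1*i≡-i (+ suc m))))
    (Tileable-neg (Tileable-ℕ· (suc m) t))

  Tileable-⊖ : ∀ {f g} → Tileable T f → Tileable T g → Tileable T (f ⊖ g)
  Tileable-⊖ {f} {g} tf tg =
    Tileable-resp (λ c → cong (_+_ (f c)) (ℤ.-1*i≡-i (g c))) (Tileable-⊕ tf (Tileable-· -1ℤ tg))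

  Tileable-⨁ : ∀ n {F : ℕ → Chain} → (∀ i → Tileable T (F i)) → Tileable T (⨁ n F)
  Tileable-⨁ zero    _ = Tileable-𝟘
  Tileable-⨁ (suc n) t = Tileable-⊕ (t 0) (Tileable-⨁ n (t ∘ suc))

  Tileable-tile : ∀ {t} → t ∈ T → ∀ o → Tileable T (𝟙 (translate o t))
  Tileable-tile {t} t∈T o = place t t∈T o Sign.+ ∷ [] , λ c →
    trans (ℤ.+-identityʳ _) (trans (covers≡ t∈T o Sign.+ c) (ℤ.*-identityˡ _))

_ᵀ : Chain → Chain
(f ᵀ) c = f (swap c)

IsTransposeOf : Tile → Tile → Set
IsTransposeOf t′ t = ∀ x → x ∈ t′ ⇔ swap x ∈ t

TransposeClosed : TileSet → Set
TransposeClosed T = ∀ {t} → t ∈ T → Σ[ t′ ∈ Tile ] t′ ∈ T × IsTransposeOf t′ t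

δ-ᵀ : ∀ x c → δ x (swap c) ≡ δ (swap x) c
δ-ᵀ x c with c ≟c swap x
... | yes c≡x′ = δ-≡ (cong swap c≡x′)
... | no  c≢x′ = δ-≢ (λ c′≡x → c≢x′ (cong swap c′≡x))

∈-translate-ᵀ : ∀ {t t′} → IsTransposeOf t′ t → ∀ o c → c ∈ translate (swap o) t′ ⇔ swap c ∈ translate o t
∈-translate-ᵀ {t} {t′} t′ᵀt o c = mk⇔ to from
  where
  to : c ∈ translate (swap o) t′ → swap c ∈ translate o t
  to c∈ with ∈-map⁻ _ c∈
  ... | x , x∈t′ , c≡ = subst (_∈ translate o t) (cong swap (sym c≡)) (∈-map⁺ _ (Equivalence.to (t′ᵀt x) x∈t′))
  from : swap c ∈ translate o t → c ∈ translate (swap o) t′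
  from c′∈ with ∈-map⁻ _ c′∈
  ... | y , y∈t , c′≡ = subst (_∈ translate (swap o) t′) (cong swap (sym c′≡)) (∈-map⁺ _ (Equivalence.from (t′ᵀt (swap y)) y∈t))

Tileable-ᵀ : ∀ {T f} → TransposeClosed T → Tileable T f → Tileable T (f ᵀ)
Tileable-ᵀ {T} {f} closed (ps , cov) = map transpose ps , λ c → begin
  ∑ᴸ (map transpose ps) (λ p → covers p c) ≡⟨ ∑ᴸ-map transpose ps _ ⟩
  ∑ᴸ ps (λ p → covers (transpose p) c)     ≡⟨ ∑ᴸ-cong ps (λ p → covers-transpose p c) ⟩
  coverage ps (swap c)                     ≡⟨ cov (swap c) ⟩
  f (swap c)                               ∎
  where
  open ≡-Reasoning
  transpose : Placement T → Placement T
  transpose (place t t∈T o s) = let (t′ , t′∈T , _) = closed t∈T in place t′ t′∈T (swap o) s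
  covers-transpose : ∀ p c → covers (transpose p) c ≡ covers p (swap c)
  covers-transpose (place t t∈T o s) c = let (t′ , t′∈T , t′ᵀt) = closed t∈T in begin
    covers (place t′ t′∈T (swap o) s) c    ≡⟨ covers≡ t′∈T (swap o) s c ⟩
    weight s * 𝟙 (translate (swap o) t′) c ≡⟨ cong (weight s *_) (𝟙-cong (∈-translate-ᵀ t′ᵀt o c)) ⟩
    weight s * 𝟙 (translate o t) (swap c)  ≡⟨ sym (covers≡ t∈T o s (swap c)) ⟩
    covers (place t t∈T o s) (swap c)      ∎

-- Congruence modulo tileable chains

module Modulo (T : TileSet) where

  infix 4 _∼_

  -- A record rather than a synonym for Tileable T (f ⊖ g), so that f and g stay inferable.
  record _∼_ (f g : Chain) : Set where
    constructor by-tiling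
    field difference : Tileable T (f ⊖ g)
  open _∼_

  ≗⇒∼ : ∀ {f g} → f ≗ g → f ∼ g
  ≗⇒∼ {f} f≗g =
    by-tiling (Tileable-resp (λ c → sym (trans (cong (_-_ (f c)) (sym (f≗g c))) (ℤ.+-inverseʳ (f c)))) Tileable-𝟘)

  ∼-refl : ∀ {f} → f ∼ f
  ∼-refl = ≗⇒∼ (λ _ → refl)

  ∼-sym : ∀ {f g} → f ∼ g → g ∼ f
  ∼-sym {f} {g} (by-tiling f-g) = by-tiling (Tileable-resp (λ c → flip (f c) (g c)) (Tileable-· -1ℤ f-g))
    where
    flip : ∀ a b → -1ℤ * (a - b) ≡ b - a
    flip = solve-∀

  ∼-trans : ∀ {f g h} → f ∼ g → g ∼ h → f ∼ h
  ∼-trans {f} {g} {h} (by-tiling f-g) (by-tiling g-h) =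
    by-tiling (Tileable-resp (λ c → chain (f c) (g c) (h c)) (Tileable-⊕ f-g g-h))
    where
    chain : ∀ a b d → a - b + (b - d) ≡ a - d
    chain = solve-∀

  ∼-isEquivalence : IsEquivalence _∼_
  ∼-isEquivalence = record { refl = ∼-refl ; sym = ∼-sym ; trans = ∼-trans }

  ∼-setoid : Setoid _ _
  ∼-setoid = record { isEquivalence = ∼-isEquivalence }

  module ∼-Reasoning = SetoidReasoning ∼-setoid

  ∼-⊕ : ∀ {f f′ g g′} → f ∼ f′ → g ∼ g′ → f ⊕ g ∼ f′ ⊕ g′
  ∼-⊕ {f} {f′} {g} {g′} (by-tiling f-f′) (by-tiling g-g′) =
    by-tiling (Tileable-resp (λ c → medial (f c) (f′ c) (g c) (g′ c)) (Tileable-⊕ f-f′ g-g′))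
    where
    medial : ∀ a a′ b b′ → a - a′ + (b - b′) ≡ a + b - (a′ + b′)
    medial = solve-∀

  ∼-· : ∀ z {f g} → f ∼ g → z · f ∼ z · g
  ∼-· z {f} {g} (by-tiling f-g) = by-tiling (Tileable-resp
    (λ c → trans (ℤ.*-distribˡ-+ z (f c) (- g c)) (cong (_+_ (z * f c)) (sym (ℤ.neg-distribʳ-* z (g c)))))
    (Tileable-· z f-g))

  ∼-⨁ : ∀ n {F G : ℕ → Chain} → (∀ i → F i ∼ G i) → ⨁ n F ∼ ⨁ n G
  ∼-⨁ n {F} {G} F∼G =
    by-tiling (Tileable-resp (λ c → ∑-- n (λ i → F i c) (λ i → G i c)) (Tileable-⨁ n (difference ∘ F∼G)))

  ∼-⊖ : ∀ {f f′ g g′} → f ∼ f′ → g ∼ g′ → f ⊖ g ∼ f′ ⊖ g′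
  ∼-⊖ {f} {f′} {g} {g′} (by-tiling f-f′) (by-tiling g-g′) =
    by-tiling (Tileable-resp (λ c → regroup (f c) (f′ c) (g c) (g′ c)) (Tileable-⊕ f-f′ (Tileable-· -1ℤ g-g′)))
    where
    regroup : ∀ a a′ b b′ → a - a′ + -1ℤ * (b - b′) ≡ a - b - (a′ - b′)
    regroup = solve-∀

  Tileable⇒∼𝟘 : ∀ {f} → Tileable T f → f ∼ 𝟘
  Tileable⇒∼𝟘 t = by-tiling (Tileable-resp (λ c → sym (ℤ.+-identityʳ _)) t)

  ∼𝟘⇒Tileable : ∀ {f} → f ∼ 𝟘 → Tileable T f
  ∼𝟘⇒Tileable (by-tiling t) = Tileable-resp (λ c → ℤ.+-identityʳ _) t

  Tileable⇒∼-neg : ∀ {f g} → Tileable T (f ⊕ g) → f ∼ -1ℤ · g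
  Tileable⇒∼-neg {f} {g} t = by-tiling (Tileable-resp (λ c → sym (cancel (f c) (g c))) t)
    where
    cancel : ∀ x y → x - -1ℤ * y ≡ x + y
    cancel = solve-∀

  ⨁-pairs-∼𝟘 : ∀ {F : ℕ → Chain} → (∀ i → F i ⊕ F (suc i) ∼ 𝟘) → ∀ h → ⨁ (double h) F ∼ 𝟘
  ⨁-pairs-∼𝟘 {F} adjacent h = begin
    ⨁ (double h) F                              ≈⟨ ≗⇒∼ (λ c → ∑-pairs h (λ i → F i c)) ⟩
    ⨁[ i < h ] (F (double i) ⊕ F (suc (double i))) ≈⟨ ∼-⨁ h (λ i → adjacent (double i)) ⟩
    ⨁[ i < h ] 𝟘                                  ≈⟨ ≗⇒∼ (λ _ → ∑-zero h) ⟩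
    𝟘                                           ∎
    where open ∼-Reasoning

  ∼-ᵀ : TransposeClosed T → ∀ {f g} → f ∼ g → f ᵀ ∼ g ᵀ
  ∼-ᵀ closed (by-tiling t) = by-tiling (Tileable-ᵀ closed t)

rectCells : ℕ → ℕ → List Cell
rectCells p q = cartesianProduct (map +_ (upTo p)) (map +_ (upTo q))

rectCells-unique : ∀ p q → Unique (rectCells p q)
rectCells-unique p q =
  Unique.cartesianProduct⁺ (Unique.map⁺ ℤ.+-injective (Unique.upTo⁺ p)) (Unique.map⁺ ℤ.+-injective (Unique.upTo⁺ q))

∈-rectCells⇔ : ∀ {p q c} → c ∈ rectCells p q ⇔ Rect p q c
∈-rectCells⇔ {p} {q} {x , y} = mk⇔
  (λ c∈ → let (x∈ , y∈) = ∈-cartesianProduct⁻ _ _ c∈ in in-range x∈ , in-range y∈)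
  (λ (x∈ , y∈) → ∈-cartesianProduct⁺ (range-in x∈) (range-in y∈))
  where
  in-range : ∀ {n z} → z ∈ map +_ (upTo n) → 0ℤ ℤ.≤ z × z ℤ.< + n
  in-range z∈ with ∈-map⁻ +_ z∈
  ... | m , m∈ , refl = ℤ.+≤+ ℕ.z≤n , ℤ.+<+ (∈-upTo⁻ m∈)
  range-in : ∀ {n z} → 0ℤ ℤ.≤ z × z ℤ.< + n → z ∈ map +_ (upTo n)
  range-in (ℤ.+≤+ _ , ℤ.+<+ m<n) = ∈-map⁺ +_ (∈-upTo⁺ m<n)

∑ᴸ-rectCells : ∀ p q (F : Cell → ℤ) → ∑ᴸ (rectCells p q) F ≡ ∑[ x < p ] ∑[ y < q ] F (+ x , + y)
∑ᴸ-rectCells p q F = begin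
  ∑ᴸ (rectCells p q) F                                          ≡⟨ ∑ᴸ-cartesianProduct (map +_ (upTo p)) _ F ⟩
  ∑ᴸ (map +_ (upTo p)) (λ x → ∑ᴸ (map +_ (upTo q)) (F ∘ (x ,_))) ≡⟨ ∑ᴸ-map +_ (upTo p) _ ⟩
  ∑ᴸ (upTo p) (λ x → ∑ᴸ (map +_ (upTo q)) (F ∘ (+ x ,_)))        ≡⟨ ∑ᴸ-upTo p _ ⟩
  ∑[ x < p ] ∑ᴸ (map +_ (upTo q)) (F ∘ (+ x ,_))                ≡⟨ ∑-cong p (λ x → trans (∑ᴸ-map +_ (upTo q) _) (∑ᴸ-upTo q _)) ⟩
  ∑[ x < p ] ∑[ y < q ] F (+ x , + y)                          ∎
  where open ≡-Reasoning

χ : ℕ → ℕ → Chain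
χ p q = ⨁[ x < p ] ⨁[ y < q ] δ (+ x , + y)

χ≗𝟙 : ∀ p q → χ p q ≗ 𝟙 (rectCells p q)
χ≗𝟙 p q c = sym (trans (𝟙≡∑ᴸδ (rectCells-unique p q) c) (∑ᴸ-rectCells p q (λ x → δ x c)))

SignedTileable⇔Tileable-χ : ∀ {T} p q → SignedTileable T (Rect p q) ⇔ Tileable T (χ p q)
SignedTileable⇔Tileable-χ {T} p q = mk⇔
  (λ (ps , inside , outside) → ps , λ c → trans (cov-𝟙 ps inside outside c) (sym (χ≗𝟙 p q c)))
  (λ (ps , cov) → ps ,
    (λ c c∈R → trans (cov c) (trans (χ≗𝟙 p q c) (𝟙-∈ (Equivalence.from ∈-rectCells⇔ c∈R)))) ,
    (λ c c∉R → trans (cov c) (trans (χ≗𝟙 p q c) (𝟙-∉ (c∉R ∘ Equivalence.to ∈-rectCells⇔)))))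
  where
  cov-𝟙 : ∀ ps → (∀ c → Rect p q c → coverage ps c ≡ 1ℤ) → (∀ c → ¬ Rect p q c → coverage ps c ≡ 0ℤ) →
    ∀ c → coverage {T} ps c ≡ 𝟙 (rectCells p q) c
  cov-𝟙 ps inside outside c with c ∈? rectCells p q
  ... | yes c∈ = inside c (Equivalence.to ∈-rectCells⇔ c∈)
  ... | no  c∉ = outside c (c∉ ∘ Equivalence.from ∈-rectCells⇔)

χ-ᵀ : ∀ p q → χ p q ᵀ ≗ χ q p
χ-ᵀ p q c = begin
  ∑[ x < p ] ∑[ y < q ] δ (+ x , + y) (swap c) ≡⟨ ∑-cong p (λ x → ∑-cong q (λ y → δ-ᵀ (+ x , + y) c)) ⟩
  ∑[ x < p ] ∑[ y < q ] δ (+ y , + x) c        ≡⟨ ∑-comm p q _ ⟩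
  ∑[ y < q ] ∑[ x < p ] δ (+ y , + x) c        ∎
  where open ≡-Reasoning

χ-transpose : ∀ {T} → TransposeClosed T → ∀ p q → Tileable T (χ p q) → Tileable T (χ q p)
χ-transpose closed p q t = Tileable-resp (χ-ᵀ p q) (Tileable-ᵀ closed t)

-- Weights of signed tilings

translate-unique : ∀ o {t} → Unique t → Unique (translate o t)
translate-unique (a , b) = Unique.map⁺ shift-injective
  where
  shift-injective : ∀ {x y : Cell} → (proj₁ x + a , proj₂ x + b) ≡ (proj₁ y + a , proj₂ y + b) → x ≡ y
  shift-injective eq = cong₂ _,_ (+-cancelʳ a _ _ (cong proj₁ eq)) (+-cancelʳ b _ _ (cong proj₂ eq))

tileSum : ∀ {T} → (Cell → ℤ) → Placement T → ℤ
tileSum W (place t _ o s) = weight s * ∑ᴸ (translate o t) W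

module _ {T : TileSet} (tiles-unique : ∀ {t} → t ∈ T → Unique t) (W : Cell → ℤ) where

  cells : Placement T → List Cell
  cells (place t _ o _) = translate o t

  ∑ᴸ-*coverage : ∀ {L} → Unique L → (ps : List (Placement T)) → (∀ {p} → p ∈ ps → ∀ {x} → x ∈ cells p → x ∈ L) →
    ∑ᴸ L (λ c → W c * coverage ps c) ≡ ∑ᴸ ps (tileSum W)
  ∑ᴸ-*coverage {L} uniqL []       _    = ∑ᴸ-zero L (All.universal (λ c → ℤ.*-zeroʳ (W c)) L)
  ∑ᴸ-*coverage {L} uniqL (p@(place t t∈T o s) ∷ ps) ps⊆L = begin
    ∑ᴸ L (λ c → W c * (covers p c + coverage ps c))
      ≡⟨ ∑ᴸ-cong L (λ c → ℤ.*-distribˡ-+ (W c) _ _) ⟩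
    ∑ᴸ L (λ c → W c * covers p c + W c * coverage ps c)
      ≡⟨ ∑ᴸ-+ L _ _ ⟩
    ∑ᴸ L (λ c → W c * covers p c) + ∑ᴸ L (λ c → W c * coverage ps c)
      ≡⟨ cong₂ _+_ placed (∑ᴸ-*coverage uniqL ps (ps⊆L ∘ there)) ⟩
    tileSum W p + ∑ᴸ ps (tileSum W) ∎
    where
    open ≡-Reasoning
    swap-factors : ∀ w σ i → w * (σ * i) ≡ σ * (w * i)
    swap-factors = solve-∀
    placed : ∑ᴸ L (λ c → W c * covers p c) ≡ tileSum W p
    placed = begin
      ∑ᴸ L (λ c → W c * covers p c)
        ≡⟨ ∑ᴸ-cong L (λ c → trans (cong (W c *_) (covers≡ t∈T o s c)) (swap-factors (W c) (weight s) _)) ⟩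
      ∑ᴸ L (λ c → weight s * (W c * 𝟙 (translate o t) c)) ≡⟨ ∑ᴸ-*ˡ L (weight s) _ ⟩
      weight s * ∑ᴸ L (λ c → W c * 𝟙 (translate o t) c)
        ≡⟨ cong (weight s *_) (∑ᴸ-*𝟙 W uniqL (translate-unique o (tiles-unique t∈T)) (ps⊆L (here refl))) ⟩
      tileSum W p ∎

  -- Both sides are the sum of W · coverage over a finite set of cells containing the rectangle and all tiles.
  rect-weight≡ : ∀ p q ps → coverage ps ≗ χ p q → ∑[ x < p ] ∑[ y < q ] W (+ x , + y) ≡ ∑ᴸ ps (tileSum W)
  rect-weight≡ p q ps cov = begin
    ∑[ x < p ] ∑[ y < q ] W (+ x , + y)      ≡⟨ sym (∑ᴸ-rectCells p q W) ⟩
    ∑ᴸ (rectCells p q) W                     ≡⟨ sym (∑ᴸ-*𝟙 W uniqL (rectCells-unique p q) (∈-deduplicate⁺ _≟c_ ∘ ∈-++⁺ˡ)) ⟩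
    ∑ᴸ L (λ c → W c * 𝟙 (rectCells p q) c)   ≡⟨ ∑ᴸ-cong L (λ c → cong (W c *_) (sym (trans (cov c) (χ≗𝟙 p q c)))) ⟩
    ∑ᴸ L (λ c → W c * coverage ps c)         ≡⟨ ∑ᴸ-*coverage uniqL ps tiles⊆L ⟩
    ∑ᴸ ps (tileSum W)                        ∎
    where
    open ≡-Reasoning
    L : List Cell
    L = deduplicate _≟c_ (rectCells p q ++ concatMap cells ps)
    uniqL : Unique L
    uniqL = Unique.deduplicate-! _≟c_ _
    tiles⊆L : ∀ {p} → p ∈ ps → ∀ {x} → x ∈ cells p → x ∈ L
    tiles⊆L p∈ps x∈p = ∈-deduplicate⁺ _≟c_ (∈-++⁺ʳ (rectCells p q) (∈-concat⁺′ x∈p (∈-map⁺ cells p∈ps)))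

-- Alternating affine weights

alt : ℕ → ℤ
alt zero    = 1ℤ
alt (suc n) = - alt n

altℤ : ℤ → ℤ
altℤ (+ n)     = alt n
altℤ -[1+ n ] = - alt n

alt-double : ∀ n → alt (double n) ≡ 1ℤ
alt-double zero    = refl
alt-double (suc n) = trans (ℤ.neg-involutive (alt (double n))) (alt-double n)

+double : ∀ k → + double k ≡ + k + + k
+double k = trans (cong +_ (double≡+ k)) (ℤ.pos-+ k k)

altℤ-suc : ∀ a → altℤ (ℤ.suc a) ≡ - altℤ a
altℤ-suc (+ n)          = refl
altℤ-suc -[1+ zero ]    = refl
altℤ-suc -[1+ suc n ]   = sym (ℤ.neg-involutive (alt (suc n)))

+suc+ : ∀ i a → + suc i + a ≡ ℤ.suc (+ i + a)
+suc+ i a = ℤ.+-assoc 1ℤ (+ i) a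

+-shift : ∀ m a → + m + ℤ.suc a ≡ + suc m + a
+-shift m a = commute (+ m) a
  where
  commute : ∀ m a → m + (1ℤ + a) ≡ 1ℤ + m + a
  commute = solve-∀

altℤ-+ : ∀ i a → altℤ (+ i + a) ≡ alt i * altℤ a
altℤ-+ zero    a = trans (cong altℤ (ℤ.+-identityˡ a)) (sym (ℤ.*-identityˡ (altℤ a)))
altℤ-+ (suc i) a = begin
  altℤ (+ suc i + a)        ≡⟨ cong altℤ (+suc+ i a) ⟩
  altℤ (ℤ.suc (+ i + a))    ≡⟨ altℤ-suc (+ i + a) ⟩
  - altℤ (+ i + a)          ≡⟨ cong -_ (altℤ-+ i a) ⟩
  - (alt i * altℤ a)        ≡⟨ ℤ.neg-distribˡ-* (alt i) (altℤ a) ⟩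
  - alt i * altℤ a          ∎
  where open ≡-Reasoning

∑-alt-affine-even : ∀ h x y → ∑[ i < double h ] alt i * (x * + i + y) ≡ - (x * + h)
∑-alt-affine-even h x y = begin
  ∑[ i < double h ] alt i * (x * + i + y)
    ≡⟨ ∑-pairs h _ ⟩
  ∑[ i < h ] (alt (double i) * (x * + double i + y) + - alt (double i) * (x * + suc (double i) + y))
    ≡⟨ ∑-cong h (λ i → trans (cong (λ s → s * (x * + double i + y) + - s * (x * (1ℤ + + double i) + y)) (alt-double i))
                             (step x (+ double i) y)) ⟩
  ∑[ i < h ] (- x)
    ≡⟨ ∑-const h (- x) ⟩
  + h * - x
    ≡⟨ commute (+ h) x ⟩
  - (x * + h) ∎
  where
  open ≡-Reasoning
  step : ∀ x d y → 1ℤ * (x * d + y) + - 1ℤ * (x * (1ℤ + d) + y) ≡ - x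
  step = solve-∀
  commute : ∀ h x → h * - x ≡ - (x * h)
  commute = solve-∀

∑-alt-affine-odd : ∀ h x y → ∑[ i < suc (double h) ] alt i * (x * + i + y) ≡ y + x * + h
∑-alt-affine-odd h x y = begin
  1ℤ * (x * 0ℤ + y) + (∑[ i < double h ] - alt i * (x * + suc i + y))
    ≡⟨ cong₂ _+_ (first x y) (∑-cong (double h) (λ i → shift (alt i) x (+ i) y)) ⟩
  y + (∑[ i < double h ] - (alt i * (x * + i + (x + y))))
    ≡⟨ cong (_+_ y) (trans (∑-neg (double h) _) (cong -_ (∑-alt-affine-even h x (x + y)))) ⟩
  y + - - (x * + h)
    ≡⟨ cong (_+_ y) (ℤ.neg-involutive _) ⟩
  y + x * + h ∎
  where
  open ≡-Reasoning
  first : ∀ x y → 1ℤ * (x * 0ℤ + y) ≡ y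
  first = solve-∀
  shift : ∀ s x i y → - s * (x * (1ℤ + i) + y) ≡ - (s * (x * i + (x + y)))
  shift = solve-∀

ω : ℤ → ℤ → ℤ → Cell → ℤ
ω α β γ (x , y) = altℤ x * altℤ y * (α * x + β * y + γ)

ω-ᵀ : ∀ α β γ c → ω α β γ (swap c) ≡ ω β α γ c
ω-ᵀ α β γ (x , y) = commute (altℤ x) (altℤ y) α β γ x y
  where
  commute : ∀ s t α β γ x y → t * s * (α * y + β * x + γ) ≡ s * t * (β * x + α * y + γ)
  commute = solve-∀

ω-vbar : ∀ α β γ k a b → ∑[ j < suc (double k) ] ω α β γ (a , + j + b) ≡ altℤ a * altℤ b * (α * a + β * b + γ + β * + k)
ω-vbar α β γ k a b = begin
  ∑[ j < N ] ω α β γ (a , + j + b)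
    ≡⟨ ∑-cong N (λ j → trans (cong (λ s → altℤ a * s * (α * a + β * (+ j + b) + γ)) (altℤ-+ j b))
                              (factor (altℤ a) (alt j) (altℤ b) α a β (+ j) b γ)) ⟩
  ∑[ j < N ] altℤ a * altℤ b * (alt j * (β * + j + (α * a + β * b + γ)))
    ≡⟨ ∑-*ˡ N (altℤ a * altℤ b) (λ j → alt j * (β * + j + (α * a + β * b + γ))) ⟩
  altℤ a * altℤ b * (∑[ j < N ] alt j * (β * + j + (α * a + β * b + γ)))
    ≡⟨ cong (altℤ a * altℤ b *_) (∑-alt-affine-odd k β _) ⟩
  altℤ a * altℤ b * (α * a + β * b + γ + β * + k) ∎
  where
  open ≡-Reasoning
  N : ℕ
  N = suc (double k)
  factor : ∀ s σ t α a β j b γ → s * (σ * t) * (α * a + β * (j + b) + γ) ≡ s * t * (σ * (β * j + (α * a + β * b + γ)))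
  factor = solve-∀

ω-column : ∀ α β γ x q → ∑[ y < q ] ω α β γ (+ x , + y) ≡ alt x * (∑[ y < q ] alt y * (β * + y + (α * + x + γ)))
ω-column α β γ x q = trans (∑-cong q (λ y → factor (alt x) (alt y) α (+ x) β (+ y) γ)) (∑-*ˡ q (alt x) _)
  where
  factor : ∀ s t α x β y γ → s * t * (α * x + β * y + γ) ≡ s * (t * (β * y + (α * x + γ)))
  factor = solve-∀

ω-rect-odd×odd : ∀ α β γ a b → ∑[ x < suc (double a) ] ∑[ y < suc (double b) ] ω α β γ (+ x , + y) ≡ γ + β * + b + α * + a
ω-rect-odd×odd α β γ a b = begin
  ∑[ x < suc (double a) ] ∑[ y < suc (double b) ] ω α β γ (+ x , + y)
    ≡⟨ ∑-cong (suc (double a)) (λ x → trans (ω-column α β γ x (suc (double b))) (cong (alt x *_) (columnSum x))) ⟩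
  ∑[ x < suc (double a) ] alt x * (α * + x + (γ + β * + b))
    ≡⟨ ∑-alt-affine-odd a α (γ + β * + b) ⟩
  γ + β * + b + α * + a ∎
  where
  open ≡-Reasoning
  columnSum : ∀ x → ∑[ y < suc (double b) ] alt y * (β * + y + (α * + x + γ)) ≡ α * + x + (γ + β * + b)
  columnSum x = trans (∑-alt-affine-odd b β _) (ℤ.+-assoc (α * + x) γ _)

ω-rect-odd×even : ∀ α β γ a h → ∑[ x < suc (double a) ] ∑[ y < double h ] ω α β γ (+ x , + y) ≡ - (β * + h)
ω-rect-odd×even α β γ a h = begin
  ∑[ x < suc (double a) ] ∑[ y < double h ] ω α β γ (+ x , + y)
    ≡⟨ ∑-cong (suc (double a)) (λ x → trans (ω-column α β γ x (double h)) (cong (alt x *_) (columnSum x))) ⟩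
  ∑[ x < suc (double a) ] alt x * (0ℤ * + x + - (β * + h))
    ≡⟨ ∑-alt-affine-odd a 0ℤ (- (β * + h)) ⟩
  - (β * + h) + 0ℤ * + a
    ≡⟨ vanish (- (β * + h)) (+ a) ⟩
  - (β * + h) ∎
  where
  open ≡-Reasoning
  vanish : ∀ x a → x + 0ℤ * a ≡ x
  vanish = solve-∀
  columnSum : ∀ x → ∑[ y < double h ] alt y * (β * + y + (α * + x + γ)) ≡ 0ℤ * + x + - (β * + h)
  columnSum x = trans (∑-alt-affine-even h β _) (sym (ℤ.+-identityˡ _))

∑ᴸ-translate-upTo : ∀ o m (f : ℕ → Cell) (F : Cell → ℤ) →
  ∑ᴸ (translate o (map f (upTo m))) F ≡ ∑[ i < m ] F (proj₁ (f i) + proj₁ o , proj₂ (f i) + proj₂ o)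
∑ᴸ-translate-upTo o m f F = trans (∑ᴸ-map _ (map f (upTo m)) F) (trans (∑ᴸ-map f (upTo m) _) (∑ᴸ-upTo m _))

bar-unique : ∀ {x : Cell} {f : ℕ → Cell} {m} → (∀ {i j} → f i ≡ f j → i ≡ j) → (∀ i → x ≢ f i) →
  Unique (x ∷ map f (upTo m))
bar-unique {m = m} f-injective x∉f = All.tabulate (λ {y} y∈ → let (i , _ , y≡) = ∈-map⁻ _ y∈ in subst (_ ≢_) (sym y≡) (x∉f i))
  ∷ Unique.map⁺ f-injective (Unique.upTo⁺ m)

∑ᴸ-square2 : ∀ a b (F : Cell → ℤ) →
  ∑ᴸ (translate (a , b) square2) F ≡ F (a , b) + F (ℤ.suc a , b) + F (a , ℤ.suc b) + F (ℤ.suc a , ℤ.suc b)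
∑ᴸ-square2 a b F = begin
  F (+ 0 + a , + 0 + b) + (F (ℤ.suc a , + 0 + b) + (F (+ 0 + a , ℤ.suc b) + (F (ℤ.suc a , ℤ.suc b) + 0ℤ)))
    ≡⟨ cong₂ (λ a′ b′ → F (a′ , b′) + (F (ℤ.suc a , b′) + (F (a′ , ℤ.suc b) + (F (ℤ.suc a , ℤ.suc b) + 0ℤ))))
             (ℤ.+-identityˡ a) (ℤ.+-identityˡ b) ⟩
  F (a , b) + (F (ℤ.suc a , b) + (F (a , ℤ.suc b) + (F (ℤ.suc a , ℤ.suc b) + 0ℤ)))
    ≡⟨ reassociate (F (a , b)) (F (ℤ.suc a , b)) (F (a , ℤ.suc b)) (F (ℤ.suc a , ℤ.suc b)) ⟩
  F (a , b) + F (ℤ.suc a , b) + F (a , ℤ.suc b) + F (ℤ.suc a , ℤ.suc b) ∎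
  where
  open ≡-Reasoning
  reassociate : ∀ w x y z → w + (x + (y + (z + 0ℤ))) ≡ w + x + y + z
  reassociate = solve-∀

swap-∈-square2 : ∀ {x} → x ∈ square2 → swap x ∈ square2
swap-∈-square2 (here refl)                         = here refl
swap-∈-square2 (there (here refl))                 = there (there (here refl))
swap-∈-square2 (there (there (here refl)))         = there (here refl)
swap-∈-square2 (there (there (there (here refl)))) = there (there (there (here refl)))

∈-map-swap : ∀ {x} (t : Tile) → x ∈ map swap t ⇔ swap x ∈ t
∈-map-swap {x} t = mk⇔
  (λ x∈ → let (y , y∈t , x≡) = ∈-map⁻ swap x∈ in subst (_∈ t) (cong swap (sym x≡)) y∈t)
  (∈-map⁺ swap)

bar-ᵀ : ∀ (x : Cell) (f : ℕ → Cell) m → IsTransposeOf (swap x ∷ map (swap ∘ f) (upTo m)) (x ∷ map f (upTo m))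
bar-ᵀ x f m y =
  subst (λ t → y ∈ t ⇔ swap y ∈ x ∷ map f (upTo m)) (cong (swap x ∷_) (sym (map-∘ (upTo m)))) (∈-map-swap _)

𝒯⁺-transposeClosed : ∀ m → TransposeClosed (𝒯⁺ m)
𝒯⁺-transposeClosed m (here refl)                         = square2 , here refl , λ x → mk⇔ swap-∈-square2 swap-∈-square2
𝒯⁺-transposeClosed m (there (here refl))                 = tileC m , there (there (there (here refl))) , bar-ᵀ _ _ _
𝒯⁺-transposeClosed m (there (there (here refl)))         = tileD m , there (there (there (there (here refl)))) , bar-ᵀ _ _ _
𝒯⁺-transposeClosed m (there (there (there (here refl)))) = tileA m , there (here refl) , bar-ᵀ _ _ _
𝒯⁺-transposeClosed m (there (there (there (there (here refl))))) = tileB m , there (there (here refl)) , bar-ᵀ _ _ _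

𝒯⁺-unique : ∀ m {t} → t ∈ 𝒯⁺ m → Unique t
𝒯⁺-unique m (here refl) = ((λ ()) ∷ (λ ()) ∷ (λ ()) ∷ []) ∷ ((λ ()) ∷ (λ ()) ∷ []) ∷ ((λ ()) ∷ []) ∷ [] ∷ []
𝒯⁺-unique m (there (here refl))                         = bar-unique (λ { refl → refl }) (λ _ ())
𝒯⁺-unique m (there (there (here refl)))                 = bar-unique (λ { refl → refl }) (λ _ ())
𝒯⁺-unique m (there (there (there (here refl))))         = bar-unique (λ { refl → refl }) (λ _ ())
𝒯⁺-unique m (there (there (there (there (here refl))))) = bar-unique (λ { refl → refl }) (λ _ ())

module Shapes (k : ℕ) where

  n : ℕ
  n = double (suc k)

  N : ℕ
  N = suc (double k)

  ∑ᴸ-tileA : ∀ a b (F : Cell → ℤ) → ∑ᴸ (translate (a , b) (tileA n)) F ≡ F (ℤ.suc a , b) + (∑[ j < N ] F (a , + j + b))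
  ∑ᴸ-tileA a b F = cong₂ _+_ (cong (λ b′ → F (ℤ.suc a , b′)) (ℤ.+-identityˡ b))
    (trans (∑ᴸ-translate-upTo (a , b) N _ F) (∑-cong N (λ j → cong (λ a′ → F (a′ , + j + b)) (ℤ.+-identityˡ a))))

  ∑ᴸ-tileB : ∀ a b (F : Cell → ℤ) → ∑ᴸ (translate (a , b) (tileB n)) F ≡ F (a , + double k + b) + (∑[ j < N ] F (ℤ.suc a , + j + b))
  ∑ᴸ-tileB a b F = cong₂ _+_ (cong (λ a′ → F (a′ , + double k + b)) (ℤ.+-identityˡ a)) (∑ᴸ-translate-upTo (a , b) N _ F)

  ∑ᴸ-tileC : ∀ a b (F : Cell → ℤ) → ∑ᴸ (translate (a , b) (tileC n)) F ≡ F (a , ℤ.suc b) + (∑[ i < N ] F (+ i + a , b))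
  ∑ᴸ-tileC a b F = cong₂ _+_ (cong (λ a′ → F (a′ , ℤ.suc b)) (ℤ.+-identityˡ a))
    (trans (∑ᴸ-translate-upTo (a , b) N _ F) (∑-cong N (λ i → cong (λ b′ → F (+ i + a , b′)) (ℤ.+-identityˡ b))))

  ∑ᴸ-tileD : ∀ a b (F : Cell → ℤ) → ∑ᴸ (translate (a , b) (tileD n)) F ≡ F (+ double k + a , b) + (∑[ i < N ] F (+ i + a , ℤ.suc b))
  ∑ᴸ-tileD a b F = cong₂ _+_ (cong (λ b′ → F (+ double k + a , b′)) (ℤ.+-identityˡ b)) (∑ᴸ-translate-upTo (a , b) N _ F)

module Necessity (k : ℕ) where
  open Shapes k

  ω-square : ∀ α β γ a b →
    ω α β γ (a , b) + ω α β γ (ℤ.suc a , b) + ω α β γ (a , ℤ.suc b) + ω α β γ (ℤ.suc a , ℤ.suc b) ≡ 0ℤ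
  ω-square α β γ a b rewrite altℤ-suc a | altℤ-suc b = cancel (altℤ a) (altℤ b) α β γ a b
    where
    cancel : ∀ s t α β γ a b → s * t * (α * a + β * b + γ) + - s * t * (α * (1ℤ + a) + β * b + γ)
      + s * - t * (α * a + β * (1ℤ + b) + γ) + - s * - t * (α * (1ℤ + a) + β * (1ℤ + b) + γ) ≡ 0ℤ
    cancel = solve-∀

  ω-A : ∀ α β γ a b → ω α β γ (ℤ.suc a , b) + (∑[ j < N ] ω α β γ (a , + j + b)) ≡ altℤ a * altℤ b * (β * + k - α)
  ω-A α β γ a b rewrite ω-vbar α β γ k a b | altℤ-suc a = collect (altℤ a) (altℤ b) α β γ a b (+ k)
    where
    collect : ∀ s t α β γ a b k → - s * t * (α * (1ℤ + a) + β * b + γ) + s * t * (α * a + β * b + γ + β * k) ≡ s * t * (β * k - α)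
    collect = solve-∀

  ω-B : ∀ α β γ a b → ω α β γ (a , + double k + b) + (∑[ j < N ] ω α β γ (ℤ.suc a , + j + b)) ≡ altℤ a * altℤ b * (β * + k - α)
  ω-B α β γ a b rewrite ω-vbar α β γ k (ℤ.suc a) b | altℤ-suc a | altℤ-+ (double k) b | alt-double k | +double k =
    collect (altℤ a) (altℤ b) α β γ a b (+ k)
    where
    collect : ∀ s t α β γ a b k →
      s * (1ℤ * t) * (α * a + β * (k + k + b) + γ) + - s * t * (α * (1ℤ + a) + β * b + γ + β * k) ≡ s * t * (β * k - α)
    collect = solve-∀

  ω-C : ∀ α β γ a b → ω α β γ (a , ℤ.suc b) + (∑[ i < N ] ω α β γ (+ i + a , b)) ≡ altℤ b * altℤ a * (α * + k - β)
  ω-C α β γ a b = trans (cong₂ _+_ (ω-ᵀ α β γ (ℤ.suc b , a)) (∑-cong N (λ i → ω-ᵀ α β γ (b , + i + a)))) (ω-A β α γ b a)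

  ω-D : ∀ α β γ a b → ω α β γ (+ double k + a , b) + (∑[ i < N ] ω α β γ (+ i + a , ℤ.suc b)) ≡ altℤ b * altℤ a * (α * + k - β)
  ω-D α β γ a b =
    trans (cong₂ _+_ (ω-ᵀ α β γ (b , + double k + a)) (∑-cong N (λ i → ω-ᵀ α β γ (ℤ.suc b , + i + a)))) (ω-B β α γ b a)

  ∣ℤ0 : ∀ g → g ∣ℤ 0ℤ
  ∣ℤ0 g = ℤ∣.divides 0ℤ (sym (ℤ.*-zeroˡ g))

  placed-∣ : ∀ α β γ {g} → g ∣ℤ β * + k - α → g ∣ℤ α * + k - β →
    ∀ {t} → t ∈ 𝒯⁺ n → ∀ a b → g ∣ℤ ∑ᴸ (translate (a , b) t) (ω α β γ)
  placed-∣ α β γ {g} _ _ (here refl) a b =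
    subst (g ∣ℤ_) (sym (trans (∑ᴸ-square2 a b (ω α β γ)) (ω-square α β γ a b))) (∣ℤ0 g)
  placed-∣ α β γ {g} g∣A _ (there (here refl)) a b =
    subst (g ∣ℤ_) (sym (trans (∑ᴸ-tileA a b (ω α β γ)) (ω-A α β γ a b))) (ℤ∣.∣n⇒∣m*n (altℤ a * altℤ b) g∣A)
  placed-∣ α β γ {g} g∣A _ (there (there (here refl))) a b =
    subst (g ∣ℤ_) (sym (trans (∑ᴸ-tileB a b (ω α β γ)) (ω-B α β γ a b))) (ℤ∣.∣n⇒∣m*n (altℤ a * altℤ b) g∣A)
  placed-∣ α β γ {g} _ g∣C (there (there (there (here refl)))) a b =
    subst (g ∣ℤ_) (sym (trans (∑ᴸ-tileC a b (ω α β γ)) (ω-C α β γ a b))) (ℤ∣.∣n⇒∣m*n (altℤ b * altℤ a) g∣C)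
  placed-∣ α β γ {g} _ g∣C (there (there (there (there (here refl))))) a b =
    subst (g ∣ℤ_) (sym (trans (∑ᴸ-tileD a b (ω α β γ)) (ω-D α β γ a b))) (ℤ∣.∣n⇒∣m*n (altℤ b * altℤ a) g∣C)

  ω-rect-∣ : ∀ α β γ {g} → g ∣ℤ β * + k - α → g ∣ℤ α * + k - β →
    ∀ p q → Tileable (𝒯⁺ n) (χ p q) → g ∣ℤ ∑[ x < p ] ∑[ y < q ] ω α β γ (+ x , + y)
  ω-rect-∣ α β γ {g} g∣A g∣C p q (ps , cov) =
    subst (g ∣ℤ_) (sym (rect-weight≡ (𝒯⁺-unique n) (ω α β γ) p q ps cov)) (all-∣ ps)
    where
    all-∣ : ∀ ps → g ∣ℤ ∑ᴸ ps (tileSum (ω α β γ))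
    all-∣ []       = ∣ℤ0 g
    all-∣ (place _ t∈ (a , b) s ∷ ps) =
      ℤ∣.∣m∣n⇒∣m+n (ℤ∣.∣n⇒∣m*n (weight s) (placed-∣ α β γ g∣A g∣C t∈ a b)) (all-∣ ps)

  odd×odd-untileable : ∀ a b → ¬ Tileable (𝒯⁺ n) (χ (suc (double a)) (suc (double b)))
  odd×odd-untileable a b t = 1≢0 (begin
    1ℤ                                                                   ≡⟨ sym (ω-rect-odd×odd 0ℤ 0ℤ 1ℤ a b) ⟩
    ∑[ x < suc (double a) ] ∑[ y < suc (double b) ] ω 0ℤ 0ℤ 1ℤ (+ x , + y) ≡⟨ ℤ∣._∣_.equality 0∣sum ⟩
    ℤ∣.quotient 0∣sum * 0ℤ                                                ≡⟨ ℤ.*-zeroʳ (ℤ∣.quotient 0∣sum) ⟩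
    0ℤ                                                                   ∎)
    where
    open ≡-Reasoning
    0∣sum : 0ℤ ∣ℤ ∑[ x < suc (double a) ] ∑[ y < suc (double b) ] ω 0ℤ 0ℤ 1ℤ (+ x , + y)
    0∣sum = ω-rect-∣ 0ℤ 0ℤ 1ℤ (∣ℤ0 0ℤ) (∣ℤ0 0ℤ) (suc (double a)) (suc (double b)) t
    1≢0 : 1ℤ ≢ 0ℤ
    1≢0 ()

  odd×even-necessary : ∀ a h → Tileable (𝒯⁺ n) (χ (suc (double a)) (double h)) → + k * + k - 1ℤ ∣ℤ + h
  odd×even-necessary a h t = subst (_ ∣ℤ_) -sum≡h (ℤ∣.∣m⇒∣-m g∣sum)
    where
    g∣0 : + k * + k - 1ℤ ∣ℤ 1ℤ * + k - + k
    g∣0 = ℤ∣.divides 0ℤ (vanish (+ k))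
      where
      vanish : ∀ k → 1ℤ * k - k ≡ 0ℤ * (k * k - 1ℤ)
      vanish = solve-∀
    g∣sum : + k * + k - 1ℤ ∣ℤ ∑[ x < suc (double a) ] ∑[ y < double h ] ω (+ k) 1ℤ 0ℤ (+ x , + y)
    g∣sum = ω-rect-∣ (+ k) 1ℤ 0ℤ g∣0 ℤ∣.∣-refl (suc (double a)) (double h) t
    -sum≡h : - (∑[ x < suc (double a) ] ∑[ y < double h ] ω (+ k) 1ℤ 0ℤ (+ x , + y)) ≡ + h
    -sum≡h = trans (cong -_ (ω-rect-odd×even (+ k) 1ℤ 0ℤ a h)) (trans (ℤ.neg-involutive _) (ℤ.*-identityˡ (+ h)))

module Sufficiency (k : ℕ) where
  open Shapes k
  open Modulo (𝒯⁺ n)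

  V H : ℤ → ℤ → Chain
  V a b = δ (a , b) ⊕ δ (a , ℤ.suc b)
  H a b = δ (a , b) ⊕ δ (ℤ.suc a , b)

  vbar hbar : ℤ → ℤ → Chain
  vbar a b = ⨁[ j < N ] δ (a , + j + b)
  hbar a b = ⨁[ i < N ] δ (+ i + a , b)

  Tileable-placed : ∀ {t} → t ∈ 𝒯⁺ n → ∀ o {f} → (∀ c → ∑ᴸ (translate o t) (λ x → δ x c) ≡ f c) → Tileable (𝒯⁺ n) f
  Tileable-placed t∈ o eq = Tileable-resp (λ c → trans (𝟙≡∑ᴸδ (translate-unique o (𝒯⁺-unique n t∈)) c) (eq c)) (Tileable-tile t∈ o)

  square-tileable : ∀ a b → Tileable (𝒯⁺ n) (V a b ⊕ V (ℤ.suc a) b)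
  square-tileable a b = Tileable-placed (here refl) (a , b) λ c →
    trans (∑ᴸ-square2 a b (λ x → δ x c)) (regroup (δ (a , b) c) (δ (ℤ.suc a , b) c) (δ (a , ℤ.suc b) c) (δ (ℤ.suc a , ℤ.suc b) c))
    where
    regroup : ∀ w x y z → w + x + y + z ≡ w + y + (x + z)
    regroup = solve-∀

  shapeA shapeC shapeD : ℤ → ℤ → Chain
  shapeA a b = δ (ℤ.suc a , b) ⊕ vbar a b
  shapeC a b = δ (a , ℤ.suc b) ⊕ hbar a b
  shapeD a b = δ (+ double k + a , b) ⊕ hbar a (ℤ.suc b)

  tileA-tileable : ∀ a b → Tileable (𝒯⁺ n) (shapeA a b)
  tileA-tileable a b = Tileable-placed (there (here refl)) (a , b) λ c → ∑ᴸ-tileA a b (λ x → δ x c)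

  tileC-tileable : ∀ a b → Tileable (𝒯⁺ n) (shapeC a b)
  tileC-tileable a b = Tileable-placed (there (there (there (here refl)))) (a , b) λ c → ∑ᴸ-tileC a b (λ x → δ x c)

  tileD-tileable : ∀ a b → Tileable (𝒯⁺ n) (shapeD a b)
  tileD-tileable a b = Tileable-placed (there (there (there (there (here refl))))) (a , b) λ c → ∑ᴸ-tileD a b (λ x → δ x c)

  hbar-telescope : ∀ a b c → hbar a b c - hbar (ℤ.suc a) b c ≡ δ (a , b) c - δ (+ N + a , b) c
  hbar-telescope a b c = begin
    hbar a b c - hbar (ℤ.suc a) b c
      ≡⟨ cong (_-_ (hbar a b c)) (∑-cong N (λ i → cong (λ x → δ (x , b) c) (+-shift i a))) ⟩
    ∑ N f - ∑ N (f ∘ suc)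
      ≡⟨ ∑-telescope N f ⟩
    f 0 - f N
      ≡⟨ cong (λ x → δ (x , b) c - f N) (ℤ.+-identityˡ a) ⟩
    δ (a , b) c - δ (+ N + a , b) c ∎
    where
    open ≡-Reasoning
    f : ℕ → ℤ
    f i = δ (+ i + a , b) c

  -- The horizontal bars of C(a,b) - C(a+1,b) + D(a+1,b) - C(a+1,b+1) telescope away.
  V-diagonal : ∀ a b → V a b ∼ V (ℤ.suc a) (ℤ.suc b)
  V-diagonal a b = by-tiling (Tileable-resp identity (Tileable-⊕
    (Tileable-⊖ (tileC-tileable a b) (tileC-tileable a′ b))
    (Tileable-⊖ (tileD-tileable a′ b) (tileC-tileable a′ b′))))
    where
    a′ b′ : ℤ
    a′ = ℤ.suc a
    b′ = ℤ.suc b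
    identity : (shapeC a b ⊖ shapeC a′ b) ⊕ (shapeD a′ b ⊖ shapeC a′ b′) ≗ V a b ⊖ V a′ b′
    identity c = begin
      d a b′ + hbar a b c - (d a′ b′ + hbar a′ b c) + (d (+ double k + a′) b + hbar a′ b′ c - (d a′ (ℤ.suc b′) + hbar a′ b′ c))
        ≡⟨ regroup (d a b′) (d a′ b′) (d (+ double k + a′) b) (d a′ (ℤ.suc b′)) (hbar a b c) (hbar a′ b c) (hbar a′ b′ c) ⟩
      d a b′ - d a′ b′ + d (+ double k + a′) b - d a′ (ℤ.suc b′) + (hbar a b c - hbar a′ b c)
        ≡⟨ cong₂ (λ x t → d a b′ - d a′ b′ + d x b - d a′ (ℤ.suc b′) + t) (+-shift (double k) a) (hbar-telescope a b c) ⟩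
      d a b′ - d a′ b′ + d (+ N + a) b - d a′ (ℤ.suc b′) + (d a b - d (+ N + a) b)
        ≡⟨ collect (d a b) (d a b′) (d a′ b′) (d a′ (ℤ.suc b′)) (d (+ N + a) b) ⟩
      V a b c - V a′ b′ c ∎
      where
      open ≡-Reasoning
      d : ℤ → ℤ → ℤ
      d x y = δ (x , y) c
      regroup : ∀ x₀ x₁ x₂ x₃ h₀ h₁ h₂ →
        x₀ + h₀ - (x₁ + h₁) + (x₂ + h₂ - (x₃ + h₂)) ≡ x₀ - x₁ + x₂ - x₃ + (h₀ - h₁)
      regroup = solve-∀
      collect : ∀ d₀₀ d₀₁ d₁₁ d₁₂ e → d₀₁ - d₁₁ + e - d₁₂ + (d₀₀ - e) ≡ d₀₀ + d₀₁ - (d₁₁ + d₁₂)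
      collect = solve-∀

  V-flip : ∀ a b → V a (ℤ.suc b) ∼ -1ℤ · V a b
  V-flip a b = begin
    V a (ℤ.suc b)                  ≈⟨ Tileable⇒∼-neg (square-tileable a (ℤ.suc b)) ⟩
    -1ℤ · V (ℤ.suc a) (ℤ.suc b)    ≈⟨ ∼-· -1ℤ (∼-sym (V-diagonal a b)) ⟩
    -1ℤ · V a b                    ∎
    where open ∼-Reasoning

  V-shift : ∀ a b j → V a (+ j + b) ∼ alt j · V a b
  V-shift a b zero    = ≗⇒∼ (λ c → trans (cong (λ y → V a y c) (ℤ.+-identityˡ b)) (sym (ℤ.*-identityˡ _)))
  V-shift a b (suc j) = begin
    V a (+ suc j + b)         ≈⟨ ≗⇒∼ (λ c → cong (λ y → V a y c) (+suc+ j b)) ⟩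
    V a (ℤ.suc (+ j + b))     ≈⟨ V-flip a (+ j + b) ⟩
    -1ℤ · V a (+ j + b)       ≈⟨ ∼-· -1ℤ (V-shift a b j) ⟩
    -1ℤ · (alt j · V a b)     ≈⟨ ≗⇒∼ (λ c → trans (sym (ℤ.*-assoc -1ℤ (alt j) _)) (cong (_* V a b c) (ℤ.-1*i≡-i (alt j)))) ⟩
    alt (suc j) · V a b       ∎
    where open ∼-Reasoning

  V-shift-even : ∀ a b i → V a (+ double i + b) ∼ V a b
  V-shift-even a b i = ∼-trans (V-shift a b (double i)) (≗⇒∼ (λ c → trans (cong (_* V a b c) (alt-double i)) (ℤ.*-identityˡ _)))

  V-shift-odd : ∀ a b i → V a (+ suc (double i) + b) ∼ -1ℤ · V a b
  V-shift-odd a b i = ∼-trans (V-shift a b (suc (double i))) (≗⇒∼ (λ c → cong (λ s → - s * V a b c) (alt-double i)))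

  vbar-pairs : ∀ a b → vbar a b ≗ δ (a , b) ⊕ (⨁[ i < k ] V a (+ suc (double i) + b))
  vbar-pairs a b c = cong₂ _+_ (cong (λ y → δ (a , y) c) (ℤ.+-identityˡ b))
    (trans (∑-pairs k (λ j → δ (a , + suc j + b) c))
           (∑-cong k (λ i → cong (λ y → δ (a , + suc (double i) + b) c + δ (a , y) c) (+suc+ (suc (double i)) b))))

  vbar∼ : ∀ a b → vbar a b ∼ δ (a , b) ⊖ + k · V a b
  vbar∼ a b = begin
    vbar a b
      ≈⟨ ≗⇒∼ (vbar-pairs a b) ⟩
    δ (a , b) ⊕ (⨁[ i < k ] V a (+ suc (double i) + b))
      ≈⟨ ∼-⊕ (∼-refl {δ (a , b)}) (∼-⨁ k (V-shift-odd a b)) ⟩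
    δ (a , b) ⊕ (⨁[ i < k ] -1ℤ · V a b)
      ≈⟨ ≗⇒∼ (λ c → cong (_+_ (δ (a , b) c)) (trans (∑-const k _) (pull (+ k) (V a b c)))) ⟩
    δ (a , b) ⊖ + k · V a b ∎
    where
    open ∼-Reasoning
    pull : ∀ k v → k * (-1ℤ * v) ≡ - (k * v)
    pull = solve-∀

  H∼kV : ∀ a b → H a b ∼ + k · V a b
  H∼kV a b = begin
    H a b
      ≈⟨ ≗⇒∼ (λ c → split (δ (a , b) c) (δ (ℤ.suc a , b) c) (vbar a b c)) ⟩
    shapeA a b ⊕ (δ (a , b) ⊖ vbar a b)
      ≈⟨ ∼-⊕ (Tileable⇒∼𝟘 (tileA-tileable a b)) (∼-⊖ (∼-refl {δ (a , b)}) (vbar∼ a b)) ⟩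
    𝟘 ⊕ (δ (a , b) ⊖ (δ (a , b) ⊖ + k · V a b))
      ≈⟨ ≗⇒∼ (λ c → cancel (δ (a , b) c) (+ k * V a b c)) ⟩
    + k · V a b ∎
    where
    open ∼-Reasoning
    split : ∀ d₀ d₁ v → d₀ + d₁ ≡ d₁ + v + (d₀ - v)
    split = solve-∀
    cancel : ∀ d x → 0ℤ + (d - (d - x)) ≡ x
    cancel = solve-∀

  V∼kH : ∀ a b → V a b ∼ + k · H a b
  V∼kH a b = begin
    V a b              ≈⟨ ≗⇒∼ (λ c → sym (H-ᵀ c)) ⟩
    H b a ᵀ            ≈⟨ ∼-ᵀ (𝒯⁺-transposeClosed n) (H∼kV b a) ⟩
    (+ k · V b a) ᵀ    ≈⟨ ≗⇒∼ (λ c → cong (+ k *_) (V-ᵀ c)) ⟩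
    + k · H a b        ∎
    where
    open ∼-Reasoning
    H-ᵀ : ∀ c → H b a (swap c) ≡ V a b c
    H-ᵀ c = cong₂ _+_ (δ-ᵀ (b , a) c) (δ-ᵀ (ℤ.suc b , a) c)
    V-ᵀ : ∀ c → V b a (swap c) ≡ H a b c
    V-ᵀ c = cong₂ _+_ (δ-ᵀ (b , a) c) (δ-ᵀ (b , ℤ.suc a) c)

  modulus·V∼𝟘 : ∀ a b → (+ k * + k - 1ℤ) · V a b ∼ 𝟘
  modulus·V∼𝟘 a b = begin
    (+ k * + k - 1ℤ) · V a b    ≈⟨ ≗⇒∼ (λ c → expand (+ k) (V a b c)) ⟩
    + k · (+ k · V a b) ⊖ V a b ≈⟨ ∼-⊖ (∼-· (+ k) (∼-sym (H∼kV a b))) (∼-refl {V a b}) ⟩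
    + k · H a b ⊖ V a b         ≈⟨ ∼-⊖ (∼-sym (V∼kH a b)) (∼-refl {V a b}) ⟩
    V a b ⊖ V a b               ≈⟨ ≗⇒∼ (λ c → ℤ.+-inverseʳ (V a b c)) ⟩
    𝟘                           ∎
    where
    open ∼-Reasoning
    expand : ∀ k v → (k * k - 1ℤ) * v ≡ k * (k * v) - v
    expand = solve-∀

  column : ℕ → ℕ → Chain
  column x q = ⨁[ y < q ] δ (+ x , + y)

  column-dominoes : ∀ x h → column x (double h) ≗ ⨁[ j < h ] V (+ x) (+ double j)
  column-dominoes x h c = ∑-pairs h (λ y → δ (+ x , + y) c)

  adjacent-columns∼𝟘 : ∀ h x → column x (double h) ⊕ column (suc x) (double h) ∼ 𝟘
  adjacent-columns∼𝟘 h x = begin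
    column x (double h) ⊕ column (suc x) (double h)
      ≈⟨ ≗⇒∼ (λ c → trans (cong₂ _+_ (column-dominoes x h c) (column-dominoes (suc x) h c)) (sym (∑-+ h _ _))) ⟩
    ⨁[ j < h ] (V (+ x) (+ double j) ⊕ V (+ suc x) (+ double j))
      ≈⟨ ∼-⨁ h (λ j → Tileable⇒∼𝟘 (square-tileable (+ x) (+ double j))) ⟩
    ⨁[ j < h ] 𝟘
      ≈⟨ ≗⇒∼ (λ _ → ∑-zero h) ⟩
    𝟘 ∎
    where open ∼-Reasoning

  first-column∼𝟘 : ∀ h → + k * + k - 1ℤ ∣ℤ + h → column 0 (double h) ∼ 𝟘
  first-column∼𝟘 h (ℤ∣.divides t h≡t*g) = begin
    column 0 (double h)
      ≈⟨ ≗⇒∼ (column-dominoes 0 h) ⟩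
    ⨁[ j < h ] V (+ 0) (+ double j)
      ≈⟨ ≗⇒∼ (λ c → ∑-cong h (λ j → cong (λ y → V (+ 0) y c) (sym (ℤ.+-identityʳ (+ double j))))) ⟩
    ⨁[ j < h ] V (+ 0) (+ double j + 0ℤ)
      ≈⟨ ∼-⨁ h (V-shift-even (+ 0) 0ℤ) ⟩
    ⨁[ j < h ] V (+ 0) 0ℤ
      ≈⟨ ≗⇒∼ (λ c → trans (∑-const h _) (trans (cong (_* V (+ 0) 0ℤ c) h≡t*g) (ℤ.*-assoc t _ _))) ⟩
    t · ((+ k * + k - 1ℤ) · V (+ 0) 0ℤ)
      ≈⟨ ∼-· t (modulus·V∼𝟘 (+ 0) 0ℤ) ⟩
    t · 𝟘
      ≈⟨ ≗⇒∼ (λ _ → ℤ.*-zeroʳ t) ⟩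
    𝟘 ∎
    where open ∼-Reasoning

  even×even-tileable : ∀ a h → Tileable (𝒯⁺ n) (χ (double a) (double h))
  even×even-tileable a h = ∼𝟘⇒Tileable (⨁-pairs-∼𝟘 (adjacent-columns∼𝟘 h) a)

  odd×even-tileable : ∀ a h → + k * + k - 1ℤ ∣ℤ + h → Tileable (𝒯⁺ n) (χ (suc (double a)) (double h))
  odd×even-tileable a h g∣h = ∼𝟘⇒Tileable (begin
    χ (suc (double a)) (double h)                                  ≡⟨⟩
    column 0 (double h) ⊕ (⨁[ x < double a ] column (suc x) (double h))
      ≈⟨ ∼-⊕ (first-column∼𝟘 h g∣h) (⨁-pairs-∼𝟘 (adjacent-columns∼𝟘 h ∘ suc) a) ⟩
    𝟘 ⊕ 𝟘                                                        ≈⟨ ≗⇒∼ (λ _ → refl) ⟩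
    𝟘                                                            ∎)
    where open ∼-Reasoning

-- The characterization

Condition : ℕ → ℕ → ℕ → Set
Condition M p q = (2 ∣ p × 2 ∣ q) ⊎ (¬ 2 ∣ p × M ∣ q) ⊎ (¬ 2 ∣ q × M ∣ p)

Condition-comm : ∀ M p q → Condition M p q ⇔ Condition M q p
Condition-comm M p q = mk⇔ flip flip
  where
  flip : ∀ {p q} → Condition M p q → Condition M q p
  flip (inj₁ (2∣p , 2∣q))       = inj₁ (2∣q , 2∣p)
  flip (inj₂ (inj₁ odd-p))      = inj₂ (inj₂ odd-p)
  flip (inj₂ (inj₂ odd-q))      = inj₂ (inj₁ odd-q)

Condition-odd : ∀ m a q → Condition (double m) (suc (double a)) q ⇔ double m ∣ q
Condition-odd m a q = mk⇔ to (λ M∣q → inj₂ (inj₁ (2∤odd a , M∣q)))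
  where
  to : Condition (double m) (suc (double a)) q → double m ∣ q
  to (inj₁ (2∣p , _))            = ⊥-elim (2∤odd a 2∣p)
  to (inj₂ (inj₁ (_ , M∣q)))     = M∣q
  to (inj₂ (inj₂ (_ , M∣p)))     = ⊥-elim (double∤odd m a M∣p)

module Characterization (k : ℕ) where
  open Shapes k
  open Necessity k
  open Sufficiency k

  -- With n = 2k + 2 and k ≥ 1 this is n (n/2 − 2).
  modulus : ℕ
  modulus = double ℤ.∣ + k * + k - 1ℤ ∣

  odd-row⇔ : ∀ a q → Tileable (𝒯⁺ n) (χ (suc (double a)) q) ⇔ modulus ∣ q
  odd-row⇔ a q with parity q
  ... | even h = mk⇔
    (λ t → Equivalence.to (∣⇔double∣double _ h) (ℤ∣.∣⇒∣ᵤ (odd×even-necessary a h t)))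
    (λ M∣q → odd×even-tileable a h (ℤ∣.∣ᵤ⇒∣ (Equivalence.from (∣⇔double∣double _ h) M∣q)))
  ... | odd b = mk⇔ (⊥-elim ∘ odd×odd-untileable a b) (⊥-elim ∘ double∤odd _ b)

  Tileable⇔Condition : ∀ p q → Tileable (𝒯⁺ n) (χ p q) ⇔ Condition modulus p q
  Tileable⇔Condition p q with parity p | parity q
  ... | odd a  | _      = ⇔-trans (odd-row⇔ a q) (⇔-sym (Condition-odd _ a q))
  ... | even a | even b = mk⇔ (λ _ → inj₁ (2∣double a , 2∣double b)) (λ _ → even×even-tileable a b)
  ... | even a | odd b  = begin
    Tileable (𝒯⁺ n) (χ (double a) (suc (double b)))
      ≈⟨ mk⇔ (χ-transpose closed (double a) (suc (double b))) (χ-transpose closed (suc (double b)) (double a)) ⟩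
    Tileable (𝒯⁺ n) (χ (suc (double b)) (double a))  ≈⟨ odd-row⇔ b (double a) ⟩
    modulus ∣ double a                               ≈⟨ ⇔-sym (Condition-odd _ b _) ⟩
    Condition modulus (suc (double b)) (double a)    ≈⟨ Condition-comm _ _ _ ⟩
    Condition modulus (double a) (suc (double b))    ∎
    where
    open SetoidReasoning (⇔-setoid 0ℓ)
    closed : TransposeClosed (𝒯⁺ n)
    closed = 𝒯⁺-transposeClosed n

SignedTileable⇔Condition : ∀ k p q → SignedTileable (𝒯⁺ (double (suc k))) (Rect p q) ⇔ Condition (Characterization.modulus k) p q
SignedTileable⇔Condition k p q = ⇔-trans (SignedTileable⇔Tileable-χ p q) (Characterization.Tileable⇔Condition k p q)

Condition-0 : ∀ {p q} → 1 ≤ p → 1 ≤ q → Condition 0 p q ⇔ (2 ∣ p × 2 ∣ q)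
Condition-0 {p} {q} 1≤p 1≤q = mk⇔ to inj₁
  where
  to : Condition 0 p q → 2 ∣ p × 2 ∣ q
  to (inj₁ 2∣p×2∣q)          = 2∣p×2∣q
  to (inj₂ (inj₁ (_ , 0∣q))) = ⊥-elim (ℕ.<⇒≢ 1≤q (sym (0∣⇒≡0 0∣q)))
  to (inj₂ (inj₂ (_ , 0∣p))) = ⊥-elim (ℕ.<⇒≢ 1≤p (sym (0∣⇒≡0 0∣p)))

even≥6 : ∀ {n} → 2 ∣ n → 6 ≤ n → ∃ λ j → n ≡ double (2 ℕ.+ j)
even≥6 {n} 2∣n 6≤n with parity n
even≥6 2∣n 6≤n            | odd h              = ⊥-elim (2∤odd h 2∣n)
even≥6 _   6≤n            | even (suc (suc j)) = j , refl
even≥6 _   ()             | even zero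
even≥6 _   (s≤s (s≤s ())) | even (suc zero)

modulus≡ : ∀ j → let n = double (2 ℕ.+ j) in n ℕ.* (n / 2 ∸ 2) ≡ Characterization.modulus (suc j)
modulus≡ j = begin
  double (2 ℕ.+ j) ℕ.* (double (2 ℕ.+ j) / 2 ∸ 2) ≡⟨ cong (λ m → double (2 ℕ.+ j) ℕ.* (m ∸ 2)) half ⟩
  double (2 ℕ.+ j) ℕ.* j                         ≡⟨ ℕ.*-comm (double (2 ℕ.+ j)) j ⟩
  j ℕ.* double (2 ℕ.+ j)                         ≡⟨ sym (*-double j (2 ℕ.+ j)) ⟩
  double (j ℕ.* (2 ℕ.+ j))                       ≡⟨ cong (double ∘ ℤ.∣_∣) (sym modulus-ℤ) ⟩
  double ℤ.∣ + suc j * + suc j - 1ℤ ∣            ∎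
  where
  open ≡-Reasoning
  half : double (2 ℕ.+ j) / 2 ≡ 2 ℕ.+ j
  half = trans (cong (_/ 2) (double≡*2 (2 ℕ.+ j))) (m*n/n≡m (2 ℕ.+ j) 2)
  modulus-ℤ : + suc j * + suc j - 1ℤ ≡ + (j ℕ.* (2 ℕ.+ j))
  modulus-ℤ = trans (square-1 (+ j)) (sym (ℤ.pos-* j (2 ℕ.+ j)))
    where
    square-1 : ∀ j → (1ℤ + j) * (1ℤ + j) - 1ℤ ≡ j * (+ 2 + j)
    square-1 = solve-∀

𝒯⁺₄-rect⇔ : ∀ {p q} → 1 ≤ p → 1 ≤ q → SignedTileable (𝒯⁺ 4) (Rect p q) ⇔ (2 ∣ p × 2 ∣ q)
𝒯⁺₄-rect⇔ {p} {q} 1≤p 1≤q = ⇔-trans (SignedTileable⇔Condition 1 p q) (Condition-0 1≤p 1≤q)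

𝒯⁺-rect⇔ : ∀ {n} → 2 ∣ n → 6 ≤ n → ∀ p q → SignedTileable (𝒯⁺ n) (Rect p q) ⇔ Condition (n ℕ.* (n / 2 ∸ 2)) p q
𝒯⁺-rect⇔ 2∣n 6≤n p q with even≥6 2∣n 6≤n
... | j , refl = subst (λ M → SignedTileable (𝒯⁺ (double (2 ℕ.+ j))) (Rect p q) ⇔ Condition M p q)
                       (sym (modulus≡ j)) (SignedTileable⇔Condition (suc j) p q)

theorem2 : ((p q : ℕ) → 1 ≤ p → 1 ≤ q →
      SignedTileable (𝒯⁺ 4) (Rect p q) ⇔ (2 ∣ p × 2 ∣ q))
    ×
    ((n : ℕ) → 2 ∣ n → 6 ≤ n → (p q : ℕ) → 1 ≤ p → 1 ≤ q →
      SignedTileable (𝒯⁺ n) (Rect p q)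
        ⇔ ((2 ∣ p × 2 ∣ q)
           ⊎ (¬ 2 ∣ p × n ℕ.* (n / 2 ∸ 2) ∣ q)
           ⊎ (¬ 2 ∣ q × n ℕ.* (n / 2 ∸ 2) ∣ p)))
theorem2 = (λ p q → 𝒯⁺₄-rect⇔) , (λ n 2∣n 6≤n p q _ _ → 𝒯⁺-rect⇔ 2∣n 6≤n p q)
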